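{- Let $f=f(x_1,\ldots,x_n)$ be a positive canalyzing Boolean function with $k\ge0$ relevant variables. Then $f$ has at least $k+1$ extremal points. Moreover, $f$ has exactly $k+1$ extremal points if and only if $f$ is linear read-once.
   Context: $B=\{0,1\}$; $\mathbf{x}\preceq\mathbf{y}$ means $(\mathbf{x})_i=1\Rightarrow(\mathbf{y})_i=1$ for all $i$. $f$ is positive if $f(\mathbf{x})=1$ and $\mathbf{x}\preceq\mathbf{y}$ imply $f(\mathbf{y})=1$. Extremal points: maximal false points and minimal true points of $f$ under $\preceq$. For $\alpha\in\{0,1\}$, $f_{|x_i=\alpha}$ denotes the function of the remaining $n-1$ variables obtained by fixing $x_i=\alpha$. A variable $x_i$ is relevant if $f_{|x_i=0}\not\equiv f_{|x_i=1}$. $f$ is canalyzing if there is $i\in[n]$ such that $f_{|x_i=0}$ or $f_{|x_i=1}$ is constant. A Boolean function is linear read-once (lro) if it is constant or representable by a nested formula: the literals $x,\overline{x}$ are nested formulas, and if $t$ is a nested formula not containing $x$ or $\overline{x}$ then $x\vee t$, $x\wedge t$, $\overline{x}\vee t$, $\overline{x}\wedge t$ are nested formulas. -}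

module Defs where

open import Data.Bool using (Bool; true; false; not; _∨_; _∧_; if_then_else_)
open import Data.Nat using (ℕ; zero; suc)
open import Data.Fin using (Fin)
open import Data.Vec using (Vec; lookup; insertAt)
open import Data.List using (List; []; _∷_; [_])
open import Data.List.Membership.Propositional using (_∈_; _∉_)
open import Data.Product using (Σ; ∃; _×_; _,_)
open import Data.Sum using (_⊎_)
open import Data.Empty using (⊥)
open import Relation.Nullary using (¬_)
open import Relation.Binary.PropositionalEquality using (_≡_)

-- Boolean functions of n variables; points of B^n are vectors (true = 1, false = 0)
BoolFn : ℕ → Set
BoolFn n = Vec Bool n → Bool

_⪯_ : ∀ {n} → Vec Bool n → Vec Bool n → Set
x ⪯ y = ∀ i → lookup x i ≡ true → lookup y i ≡ true

Positive : ∀ {n} → BoolFn n → Set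
Positive f = ∀ x y → f x ≡ true → x ⪯ y → f y ≡ true

MaxFalse : ∀ {n} → BoolFn n → Vec Bool n → Set
MaxFalse f x = f x ≡ false × (∀ y → x ⪯ y → f y ≡ false → y ≡ x)

MinTrue : ∀ {n} → BoolFn n → Vec Bool n → Set
MinTrue f x = f x ≡ true × (∀ y → y ⪯ x → f y ≡ true → y ≡ x)

Extremal : ∀ {n} → BoolFn n → Vec Bool n → Set
Extremal f x = MaxFalse f x ⊎ MinTrue f x

Constant : ∀ {n} → BoolFn n → Set
Constant f = ∃ λ c → ∀ x → f x ≡ c

restrict : ∀ {m} → BoolFn (suc m) → Fin (suc m) → Bool → BoolFn m
restrict f i α y = f (insertAt y i α)

Relevant : ∀ {n} → BoolFn n → Fin n → Set
Relevant {zero} f ()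
Relevant {suc m} f i = ¬ (∀ y → restrict f i false y ≡ restrict f i true y)

Canalyzing : ∀ {n} → BoolFn n → Set
Canalyzing {zero} f = ⊥
Canalyzing {suc m} f =
  ∃ λ i → Constant (restrict f i false) ⊎ Constant (restrict f i true)

litVal : ∀ {n} → Vec Bool n → Fin n → Bool → Bool
litVal x i p = if p then lookup x i else not (lookup x i)

-- nested formulas, indexed by the list of variables they contain
-- op = true means ∨, op = false means ∧
data Nested (n : ℕ) : List (Fin n) → Set where
  lit : (i : Fin n) (p : Bool) → Nested n [ i ]
  ext : ∀ {vs} (i : Fin n) (p : Bool) (op : Bool) → Nested n vs → i ∉ vs →
        Nested n (i ∷ vs)

eval : ∀ {n vs} → Nested n vs → Vec Bool n → Bool
eval (lit i p) x = litVal x i p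
eval (ext i p true t _) x = litVal x i p ∨ eval t x
eval (ext i p false t _) x = litVal x i p ∧ eval t x

LinearReadOnce : ∀ {n} → BoolFn n → Set
LinearReadOnce {n} f =
  Constant f ⊎ (Σ (List (Fin n)) λ vs → Σ (Nested n vs) λ t → ∀ x → f x ≡ eval t x)

-- Split a positive f along a variable x_i into g₀ = f|x_i=0 ≤ g₁ = f|x_i=1. The minimal true points of f
-- are those of g₀ (with x_i = 0) and the A minimal true points of g₁ where g₀ is false (with x_i = 1);
-- dually for the maximal false points, giving B of them from g₀. So with T and F counting minimal true and
-- maximal false points, #extremal f = T g₀ + A + B + F g₁, while T g₁ ≤ T g₀ + A, F g₀ ≤ B + F g₁ and
-- A, B ≥ 1 when x_i is relevant. If x_i is a relevant variable lying in as few minimal true points as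
-- possible, the relevant variables of one restriction are among those of the other, and induction on n
-- gives #extremal f ≥ #relevant f + 1. In the equality case every estimate is tight, which makes some x_k
-- canalyzing; then f is x_k ∨ g₀ or x_k ∧ g₁ with both counts dropping by one, so induction shows f is
-- linear read-once, and the same counts run backwards along a nested formula.

module Submission where

open import Defs
open import Algebra.Properties.CommutativeSemigroup using (interchange)
open import Data.Bool using (Bool; true; false; not; _∨_; _∧_)
open import Data.Bool.Properties using (¬-not; ∨-identityʳ; ∧-identityʳ) renaming (_≟_ to _≟ᵇ_)
open import Data.Nat using (ℕ; zero; suc; _+_; _∸_; _≤_; _<_; z≤n; s≤s; _<?_)
open import Data.Nat.Properties
open import Data.Fin using (Fin; zero; suc; punchIn; punchOut)
open import Data.Fin.Properties using (punchIn-punchOut; punchInᵢ≢i; punchIn-injective; all?; any?; ¬∀⟶∃¬)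
  renaming (_≟_ to _≟ᶠ_)
open import Data.Vec using (Vec; []; _∷_; lookup; insertAt; removeAt; _[_]≔_; replicate)
open import Data.Vec.Properties using (≡-dec; ∷-injective; insertAt-lookup; insertAt-punchIn; insertAt-removeAt;
  removeAt-insertAt; lookup∘update; lookup∘update′; lookup-replicate)
open import Data.Vec.Relation.Binary.Pointwise.Extensional using (ext; Pointwise-≡⇒≡)
open import Data.List using (List; []; _∷_; length; [_]; map)
open import Data.List.Membership.Propositional.Properties using (∈-map⁻)
open import Data.List.Relation.Unary.All.Properties using (All¬⇒¬Any)
open import Data.List.Relation.Unary.Any using (here; there)
open import Data.List.Membership.Propositional using (_∈_; _∉_)
open import Data.List.Relation.Unary.Unique.Propositional using (Unique)
open import Data.List.Relation.Unary.AllPairs using ([]; _∷_)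
open import Data.Product using (Σ; ∃; _×_; _,_; proj₁; proj₂)
open import Data.Sum using (_⊎_; inj₁; inj₂)
open import Data.Empty using (⊥-elim)
open import Function.Base using (_∘_)
open import Function.Bundles using (_⇔_; mk⇔; Equivalence)
open import Relation.Nullary using (¬_; Dec; yes; no)
open import Relation.Nullary.Decidable using (_×-dec_; _⊎-dec_; _→-dec_; ¬?; decidable-stable)
open import Relation.Binary.PropositionalEquality hiding ([_])

open import Algebra.Properties.CommutativeMonoid.Sum +-0-commutativeMonoid
  using (sum; sum-cong-≗; sum-remove; ∑-distrib-+; sum-replicate-zero)

true≢false : true ≢ false
true≢false ()

lookup-ext : ∀ {n} {A : Set} {xs ys : Vec A n} → (∀ k → lookup xs k ≡ lookup ys k) → xs ≡ ys
lookup-ext h = Pointwise-≡⇒≡ (ext h)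

_≟ᵛ_ : ∀ {n} (x y : Vec Bool n) → Dec (x ≡ y)
_≟ᵛ_ = ≡-dec _≟ᵇ_

+-interchange : ∀ a b c d → (a + b) + (c + d) ≡ (a + c) + (b + d)
+-interchange = interchange +-commutativeSemigroup

𝟙 : ∀ {P : Set} → Dec P → ℕ
𝟙 (yes _) = 1
𝟙 (no _) = 0

𝟙-yes : ∀ {P} (d : Dec P) → P → 𝟙 d ≡ 1
𝟙-yes (yes _) p = refl
𝟙-yes (no ¬p) p = ⊥-elim (¬p p)

𝟙-no : ∀ {P} (d : Dec P) → ¬ P → 𝟙 d ≡ 0
𝟙-no (yes p) ¬p = ⊥-elim (¬p p)
𝟙-no (no _) ¬p = refl

𝟙≤1 : ∀ {P} (d : Dec P) → 𝟙 d ≤ 1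
𝟙≤1 (yes _) = s≤s z≤n
𝟙≤1 (no _) = z≤n

𝟙-mono : ∀ {P Q} (d : Dec P) (e : Dec Q) → (P → Q) → 𝟙 d ≤ 𝟙 e
𝟙-mono (yes p) (yes _) f = ≤-refl
𝟙-mono (yes p) (no ¬q) f = ⊥-elim (¬q (f p))
𝟙-mono (no _) e f = z≤n

𝟙-cong : ∀ {P Q} (d : Dec P) (e : Dec Q) → (P → Q) → (Q → P) → 𝟙 d ≡ 𝟙 e
𝟙-cong d e f g = ≤-antisym (𝟙-mono d e f) (𝟙-mono e d g)

𝟙≡1⇒ : ∀ {P} (d : Dec P) → 𝟙 d ≡ 1 → P
𝟙≡1⇒ (yes p) _ = p
𝟙≡1⇒ (no _) ()

𝟙≡0⇒ : ∀ {P} (d : Dec P) → 𝟙 d ≡ 0 → ¬ P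
𝟙≡0⇒ (yes _) ()
𝟙≡0⇒ (no ¬p) _ = ¬p

𝟙-⊎ : ∀ {P Q : Set} (d : Dec P) (e : Dec Q) → ¬ (P × Q) → 𝟙 (d ⊎-dec e) ≡ 𝟙 d + 𝟙 e
𝟙-⊎ (yes p) (yes q) h = ⊥-elim (h (p , q))
𝟙-⊎ (yes p) (no _) h = refl
𝟙-⊎ (no _) (yes q) h = refl
𝟙-⊎ (no _) (no _) h = refl

𝟙-cong-⇔ : ∀ {P Q : Set} (d : Dec P) (e : Dec Q) → P ⇔ Q → 𝟙 d ≡ 𝟙 e
𝟙-cong-⇔ d e P⇔Q = 𝟙-cong d e (Equivalence.to P⇔Q) (Equivalence.from P⇔Q)

𝟙-cover : ∀ {P Q R : Set} (P? : Dec P) (Q? : Dec Q) (R? : Dec R) → (P → ¬ Q → R) →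
          𝟙 P? + 𝟙 (R? ×-dec ¬? P?) ≤ 𝟙 Q? + 𝟙 R?
𝟙-cover (yes p) (yes q) R? h = s≤s (𝟙-mono _ R? proj₁)
𝟙-cover (yes p) (no ¬q) R? h = ≤-reflexive (trans (cong suc (𝟙-no _ λ (_ , ¬p) → ¬p p)) (sym (𝟙-yes R? (h p ¬q))))
𝟙-cover (no ¬p) Q? R? h = ≤-trans (≤-reflexive (𝟙-cong _ R? proj₁ (_, ¬p))) (m≤n+m _ (𝟙 Q?))

cubeSum : ∀ n → (Vec Bool n → ℕ) → ℕ
cubeSum zero f = f []
cubeSum (suc n) f = cubeSum n (f ∘ (false ∷_)) + cubeSum n (f ∘ (true ∷_))

cubeSum-cong : ∀ {n} {f g : Vec Bool n → ℕ} → (∀ x → f x ≡ g x) → cubeSum n f ≡ cubeSum n g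
cubeSum-cong {zero} h = h []
cubeSum-cong {suc n} h = cong₂ _+_ (cubeSum-cong (h ∘ (false ∷_))) (cubeSum-cong (h ∘ (true ∷_)))

cubeSum-mono : ∀ {n} {f g : Vec Bool n → ℕ} → (∀ x → f x ≤ g x) → cubeSum n f ≤ cubeSum n g
cubeSum-mono {zero} h = h []
cubeSum-mono {suc n} h = +-mono-≤ (cubeSum-mono (h ∘ (false ∷_))) (cubeSum-mono (h ∘ (true ∷_)))

cubeSum-+ : ∀ {n} (f g : Vec Bool n → ℕ) → cubeSum n (λ x → f x + g x) ≡ cubeSum n f + cubeSum n g
cubeSum-+ {zero} f g = refl
cubeSum-+ {suc n} f g =
  trans (cong₂ _+_ (cubeSum-+ (f ∘ (false ∷_)) (g ∘ (false ∷_))) (cubeSum-+ (f ∘ (true ∷_)) (g ∘ (true ∷_))))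
        (+-interchange (cubeSum n (f ∘ (false ∷_))) (cubeSum n (g ∘ (false ∷_)))
                       (cubeSum n (f ∘ (true ∷_))) (cubeSum n (g ∘ (true ∷_))))

cubeSum-zero : ∀ {n} {f : Vec Bool n → ℕ} → (∀ x → f x ≡ 0) → cubeSum n f ≡ 0
cubeSum-zero {zero} h = h []
cubeSum-zero {suc n} h = cong₂ _+_ (cubeSum-zero (h ∘ (false ∷_))) (cubeSum-zero (h ∘ (true ∷_)))

term≤cubeSum : ∀ {n} (f : Vec Bool n → ℕ) x → f x ≤ cubeSum n f
term≤cubeSum f [] = ≤-refl
term≤cubeSum f (false ∷ x) = ≤-trans (term≤cubeSum (f ∘ (false ∷_)) x) (m≤m+n _ _)
term≤cubeSum f (true ∷ x) = ≤-trans (term≤cubeSum (f ∘ (true ∷_)) x) (m≤n+m _ _)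

cubeSum≡0⇒ : ∀ {n} (f : Vec Bool n → ℕ) → cubeSum n f ≡ 0 → ∀ x → f x ≡ 0
cubeSum≡0⇒ f e x = n≤0⇒n≡0 (subst (f x ≤_) e (term≤cubeSum f x))

cubeSum-supported : ∀ {n} (f : Vec Bool n → ℕ) x₀ → (∀ x → x ≢ x₀ → f x ≡ 0) → cubeSum n f ≡ f x₀
cubeSum-supported f [] h = refl
cubeSum-supported f (false ∷ x₀) h =
  trans (cong₂ _+_ (cubeSum-supported _ x₀ (λ x x≢ → h _ (x≢ ∘ proj₂ ∘ ∷-injective)))
                   (cubeSum-zero (λ x → h (true ∷ x) λ ())))
        (+-identityʳ _)
cubeSum-supported f (true ∷ x₀) h =
  cong₂ _+_ (cubeSum-zero (λ x → h (false ∷ x) λ ()))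
            (cubeSum-supported _ x₀ (λ x x≢ → h _ (x≢ ∘ proj₂ ∘ ∷-injective)))

cubeSum-point : ∀ {n} (x₀ : Vec Bool n) → cubeSum n (λ x → 𝟙 (x ≟ᵛ x₀)) ≡ 1
cubeSum-point x₀ = trans (cubeSum-supported _ x₀ (λ x → 𝟙-no (x ≟ᵛ x₀))) (𝟙-yes (x₀ ≟ᵛ x₀) refl)

cubeSum-≤-tight : ∀ n (f g : Vec Bool n → ℕ) → (∀ x → f x ≤ g x) → cubeSum n g ≤ cubeSum n f →
                  ∀ x → f x ≡ g x
cubeSum-≤-tight n f g f≤g Σg≤Σf x =
  ≤-antisym (f≤g x) (m∸n≡0⇒m≤n (cubeSum≡0⇒ (λ y → g y ∸ f y) Σgap≡0 x))
  where
  Σg≡Σf+Σgap : cubeSum n g ≡ cubeSum n f + cubeSum n (λ y → g y ∸ f y)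
  Σg≡Σf+Σgap = trans (cubeSum-cong (λ y → sym (m+[n∸m]≡n (f≤g y)))) (cubeSum-+ f _)
  Σgap≡0 : cubeSum n (λ y → g y ∸ f y) ≡ 0
  Σgap≡0 = n≤0⇒n≡0 (+-cancelˡ-≤ (cubeSum n f) _ 0
             (subst₂ _≤_ Σg≡Σf+Σgap (sym (+-identityʳ _)) Σg≤Σf))

cubeSum-insertAt : ∀ m (i : Fin (suc m)) (f : Vec Bool (suc m) → ℕ) →
  cubeSum (suc m) f ≡ cubeSum m (λ y → f (insertAt y i false)) + cubeSum m (λ y → f (insertAt y i true))
cubeSum-insertAt m zero f = refl
cubeSum-insertAt (suc m) (suc i) f =
  trans (cong₂ _+_ (cubeSum-insertAt m i (f ∘ (false ∷_))) (cubeSum-insertAt m i (f ∘ (true ∷_))))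
        (+-interchange (cubeSum m (λ y → f (false ∷ insertAt y i false))) (cubeSum m (λ y → f (false ∷ insertAt y i true)))
                       (cubeSum m (λ y → f (true ∷ insertAt y i false))) (cubeSum m (λ y → f (true ∷ insertAt y i true))))

∀ᵛ? : ∀ n {P : Vec Bool n → Set} → (∀ x → Dec (P x)) → Dec (∀ x → P x)
∀ᵛ? zero P? with P? []
... | yes p = yes λ { [] → p }
... | no ¬p = no λ h → ¬p (h [])
∀ᵛ? (suc n) P? with ∀ᵛ? n (P? ∘ (false ∷_)) | ∀ᵛ? n (P? ∘ (true ∷_))
... | yes p | yes q = yes λ { (false ∷ x) → p x ; (true ∷ x) → q x }
... | no ¬p | _ = no λ h → ¬p (h ∘ (false ∷_))
... | yes _ | no ¬q = no λ h → ¬q (h ∘ (true ∷_))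

∃ᵛ? : ∀ n {P : Vec Bool n → Set} → (∀ x → Dec (P x)) → Dec (∃ P)
∃ᵛ? zero P? with P? []
... | yes p = yes ([] , p)
... | no ¬p = no λ { ([] , p) → ¬p p }
∃ᵛ? (suc n) P? with ∃ᵛ? n (P? ∘ (false ∷_)) | ∃ᵛ? n (P? ∘ (true ∷_))
... | yes (x , p) | _ = yes (false ∷ x , p)
... | no _ | yes (x , p) = yes (true ∷ x , p)
... | no ¬p | no ¬q = no λ { ((false ∷ x) , p) → ¬p (x , p) ; ((true ∷ x) , p) → ¬q (x , p) }

¬∀ᵛ⇒∃¬ : ∀ n {P : Vec Bool n → Set} → (∀ x → Dec (P x)) → ¬ (∀ x → P x) → ∃ λ x → ¬ P x
¬∀ᵛ⇒∃¬ n P? ¬∀ with ∃ᵛ? n (¬? ∘ P?)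
... | yes w = w
... | no ¬∃ = ⊥-elim (¬∀ λ x → decidable-stable (P? x) (λ ¬p → ¬∃ (x , ¬p)))

cubeCount≡1⇒∃! : ∀ n {P : Vec Bool n → Set} (P? : ∀ x → Dec (P x)) → cubeSum n (𝟙 ∘ P?) ≡ 1 →
                 ∃ λ x₀ → P x₀ × (∀ x → P x → x ≡ x₀)
cubeCount≡1⇒∃! n {P} P? count≡1 with ∃ᵛ? n P?
... | no ¬∃ = ⊥-elim (1+n≢0 (trans (sym count≡1) (cubeSum-zero (λ x → 𝟙-no (P? x) (λ p → ¬∃ (x , p))))))
... | yes (x₀ , p₀) = x₀ , p₀ , unique
  where
  unique : ∀ x → P x → x ≡ x₀
  unique x p with x ≟ᵛ x₀
  ... | yes x≡x₀ = x≡x₀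
  ... | no x≢x₀ = ⊥-elim (<-irrefl refl (≤-trans two≤count (≤-reflexive count≡1)))
    where
    point+point≤𝟙 : ∀ y → 𝟙 (y ≟ᵛ x) + 𝟙 (y ≟ᵛ x₀) ≤ 𝟙 (P? y)
    point+point≤𝟙 y with y ≟ᵛ x | y ≟ᵛ x₀
    ... | yes refl | yes refl = ⊥-elim (x≢x₀ refl)
    ... | yes refl | no _ = ≤-reflexive (sym (𝟙-yes (P? y) p))
    ... | no _ | yes refl = ≤-reflexive (sym (𝟙-yes (P? y) p₀))
    ... | no _ | no _ = z≤n
    two≤count : 2 ≤ cubeSum n (𝟙 ∘ P?)
    two≤count = ≤-trans (≤-reflexive (sym (trans (cubeSum-+ {n} (λ y → 𝟙 (y ≟ᵛ x)) (λ y → 𝟙 (y ≟ᵛ x₀)))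
                                                 (cong₂ _+_ (cubeSum-point x) (cubeSum-point x₀)))))
                        (cubeSum-mono point+point≤𝟙)

sum-mono : ∀ {n} {f g : Fin n → ℕ} → (∀ k → f k ≤ g k) → sum f ≤ sum g
sum-mono {zero} h = z≤n
sum-mono {suc n} h = +-mono-≤ (h zero) (sum-mono (h ∘ suc))

sum-point : ∀ {n} (k₀ : Fin n) → sum (λ k → 𝟙 (k ≟ᶠ k₀)) ≡ 1
sum-point {suc n} k₀ = begin
  sum (λ k → 𝟙 (k ≟ᶠ k₀))                              ≡⟨ sum-remove {i = k₀} (λ k → 𝟙 (k ≟ᶠ k₀)) ⟩
  𝟙 (k₀ ≟ᶠ k₀) + sum (λ j → 𝟙 (punchIn k₀ j ≟ᶠ k₀))    ≡⟨ cong₂ _+_ (𝟙-yes (k₀ ≟ᶠ k₀) refl) rest≡0 ⟩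
  1 ∎
  where
  open ≡-Reasoning
  rest≡0 : sum (λ j → 𝟙 (punchIn k₀ j ≟ᶠ k₀)) ≡ 0
  rest≡0 = trans (sum-cong-≗ (λ j → 𝟙-no (punchIn k₀ j ≟ᶠ k₀) (punchInᵢ≢i k₀ j))) (sum-replicate-zero n)

module Counting {A : Set} (_≟_ : (x y : A) → Dec (x ≡ y)) (∑ : (A → ℕ) → ℕ)
  (∑-cong : ∀ {f g} → (∀ x → f x ≡ g x) → ∑ f ≡ ∑ g)
  (∑-+ : ∀ f g → ∑ (λ x → f x + g x) ≡ ∑ f + ∑ g)
  (∑-zero : ∑ (λ _ → 0) ≡ 0)
  (∑-point : ∀ x₀ → ∑ (λ x → 𝟙 (x ≟ x₀)) ≡ 1) where

  occurrences : A → List A → ℕ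
  occurrences y [] = 0
  occurrences y (x ∷ xs) = 𝟙 (y ≟ x) + occurrences y xs

  length≡∑occurrences : ∀ xs → length xs ≡ ∑ (λ y → occurrences y xs)
  length≡∑occurrences [] = sym ∑-zero
  length≡∑occurrences (x ∷ xs) =
    sym (trans (∑-+ _ _) (cong₂ _+_ (∑-point x) (sym (length≡∑occurrences xs))))

  occurrences-∉ : ∀ y xs → y ∉ xs → occurrences y xs ≡ 0
  occurrences-∉ y [] _ = refl
  occurrences-∉ y (x ∷ xs) y∉ = cong₂ _+_ (𝟙-no (y ≟ x) (y∉ ∘ here)) (occurrences-∉ y xs (y∉ ∘ there))

  occurrences-∈-unique : ∀ y xs → Unique xs → y ∈ xs → occurrences y xs ≡ 1
  occurrences-∈-unique y (x ∷ xs) (x∉xs ∷ _) (here refl) =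
    cong₂ _+_ (𝟙-yes (y ≟ y) refl) (occurrences-∉ y xs (All¬⇒¬Any x∉xs))
  occurrences-∈-unique y (x ∷ xs) (x∉xs ∷ u) (there y∈xs) =
    cong₂ _+_ (𝟙-no (y ≟ x) λ { refl → All¬⇒¬Any x∉xs y∈xs }) (occurrences-∈-unique y xs u y∈xs)

  length-enumeration : ∀ xs → Unique xs → {P : A → Set} (P? : ∀ x → Dec (P x)) →
                       (∀ x → (x ∈ xs) ⇔ P x) → length xs ≡ ∑ (𝟙 ∘ P?)
  length-enumeration xs u P? xs⇔P = trans (length≡∑occurrences xs) (∑-cong occurrences≡𝟙)
    where
    occurrences≡𝟙 : ∀ y → occurrences y xs ≡ 𝟙 (P? y)
    occurrences≡𝟙 y with P? y
    ... | yes p = occurrences-∈-unique y xs u (Equivalence.from (xs⇔P y) p)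
    ... | no ¬p = occurrences-∉ y xs (¬p ∘ Equivalence.to (xs⇔P y))

≡-or-punchIn : ∀ {m} (i k : Fin (suc m)) → k ≡ i ⊎ ∃ λ j → k ≡ punchIn i j
≡-or-punchIn i k with i ≟ᶠ k
... | yes i≡k = inj₁ (sym i≡k)
... | no i≢k = inj₂ (punchOut i≢k , sym (punchIn-punchOut i≢k))

insertAt-surjective : ∀ {A : Set} {m} (z : Vec A (suc m)) i → ∃ λ y → ∃ λ b → z ≡ insertAt y i b
insertAt-surjective z i = removeAt z i , lookup z i , sym (insertAt-removeAt z i)

insertAt-injective : ∀ {A : Set} {m} {y y′ : Vec A m} {i} {b b′ : A} → insertAt y i b ≡ insertAt y′ i b′ → y ≡ y′ × b ≡ b′
insertAt-injective {y = y} {y′} {i} {b} {b′} e =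
  trans (sym (removeAt-insertAt y i b)) (trans (cong (λ z → removeAt z i) e) (removeAt-insertAt y′ i b′)) ,
  trans (sym (insertAt-lookup y i b)) (trans (cong (λ z → lookup z i) e) (insertAt-lookup y′ i b′))

insertAt-[]≔-punchIn : ∀ {A : Set} {m} (y : Vec A m) i b j v →
                       insertAt y i b [ punchIn i j ]≔ v ≡ insertAt (y [ j ]≔ v) i b
insertAt-[]≔-punchIn y i b j v = lookup-ext lookups
  where
  lookups : ∀ k → lookup (insertAt y i b [ punchIn i j ]≔ v) k ≡ lookup (insertAt (y [ j ]≔ v) i b) k
  lookups k with ≡-or-punchIn i k
  ... | inj₁ refl = trans (lookup∘update′ (punchInᵢ≢i i j ∘ sym) (insertAt y i b) v)
                          (trans (insertAt-lookup y i b) (sym (insertAt-lookup _ i b)))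
  ... | inj₂ (j′ , refl) with j ≟ᶠ j′
  ... | yes refl = trans (lookup∘update (punchIn i j) (insertAt y i b) v)
                         (sym (trans (insertAt-punchIn _ i b j) (lookup∘update j y v)))
  ... | no j≢j′ = trans (lookup∘update′ (j≢j′ ∘ sym ∘ punchIn-injective i j′ j) (insertAt y i b) v)
                        (trans (insertAt-punchIn y i b j′)
                               (sym (trans (insertAt-punchIn _ i b j′) (lookup∘update′ (j≢j′ ∘ sym) y v))))

insertAt-[]≔ : ∀ {A : Set} {m} (y : Vec A m) i b c → insertAt y i b [ i ]≔ c ≡ insertAt y i c
insertAt-[]≔ y i b c = lookup-ext lookups
  where
  lookups : ∀ k → lookup (insertAt y i b [ i ]≔ c) k ≡ lookup (insertAt y i c) k
  lookups k with ≡-or-punchIn i k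
  ... | inj₁ refl = trans (lookup∘update i (insertAt y i b) c) (sym (insertAt-lookup y i c))
  ... | inj₂ (j , refl) = trans (lookup∘update′ (punchInᵢ≢i i j) (insertAt y i b) c)
                                (trans (insertAt-punchIn y i b j) (sym (insertAt-punchIn y i c j)))

⪯-refl : ∀ {n} {x : Vec Bool n} → x ⪯ x
⪯-refl i p = p

⪯-trans : ∀ {n} {x y z : Vec Bool n} → x ⪯ y → y ⪯ z → x ⪯ z
⪯-trans p q i e = q i (p i e)

_⪯?_ : ∀ {n} (x y : Vec Bool n) → Dec (x ⪯ y)
x ⪯? y = all? (λ i → (lookup x i ≟ᵇ true) →-dec (lookup y i ≟ᵇ true))

replicate-false-⪯ : ∀ {n} (y : Vec Bool n) → replicate n false ⪯ y
replicate-false-⪯ {n} y k e = ⊥-elim (true≢false (trans (sym e) (lookup-replicate k false)))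

⪯-replicate-true : ∀ {n} (y : Vec Bool n) → y ⪯ replicate n true
⪯-replicate-true {n} y k _ = lookup-replicate k true

⪯-replicate-false : ∀ {n} (y : Vec Bool n) → y ⪯ replicate n false → y ≡ replicate n false
⪯-replicate-false {n} y le = lookup-ext λ k →
  trans (¬-not (λ e → true≢false (trans (sym (le k e)) (lookup-replicate k false)))) (sym (lookup-replicate k false))

replicate-true-⪯ : ∀ {n} (y : Vec Bool n) → replicate n true ⪯ y → y ≡ replicate n true
replicate-true-⪯ {n} y le = lookup-ext λ k → trans (le k (lookup-replicate k true)) (sym (lookup-replicate k true))

insertAt-⪯ : ∀ {m} {y y′ : Vec Bool m} i {b b′} → y ⪯ y′ → (b ≡ true → b′ ≡ true) →
             insertAt y i b ⪯ insertAt y′ i b′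
insertAt-⪯ {y = y} {y′} i {b} {b′} y⪯y′ b⇒b′ k p with ≡-or-punchIn i k
... | inj₁ refl = trans (insertAt-lookup y′ i b′) (b⇒b′ (trans (sym (insertAt-lookup y i b)) p))
... | inj₂ (j , refl) = trans (insertAt-punchIn y′ i b′ j) (y⪯y′ j (trans (sym (insertAt-punchIn y i b j)) p))

insertAt-⪯⁻ : ∀ {m} {y y′ : Vec Bool m} i {b b′} → insertAt y i b ⪯ insertAt y′ i b′ →
              y ⪯ y′ × (b ≡ true → b′ ≡ true)
insertAt-⪯⁻ {y = y} {y′} i {b} {b′} le =
  (λ j p → trans (sym (insertAt-punchIn y′ i b′ j)) (le (punchIn i j) (trans (insertAt-punchIn y i b j) p))) ,
  (λ p → trans (sym (insertAt-lookup y′ i b′)) (le i (trans (insertAt-lookup y i b) p)))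

insertAt-false-⪯-true : ∀ {m} (y : Vec Bool m) i → insertAt y i false ⪯ insertAt y i true
insertAt-false-⪯-true y i = insertAt-⪯ i (⪯-refl {x = y}) (λ ())

[]≔false-⪯ : ∀ {n} (t : Vec Bool n) k → (t [ k ]≔ false) ⪯ t
[]≔false-⪯ t k k′ p with k ≟ᶠ k′
... | yes refl = ⊥-elim (true≢false (trans (sym p) (lookup∘update k t false)))
... | no k≢k′ = trans (sym (lookup∘update′ (k≢k′ ∘ sym) t false)) p

⪯-[]≔true : ∀ {n} (t : Vec Bool n) k → t ⪯ (t [ k ]≔ true)
⪯-[]≔true t k k′ p with k ≟ᶠ k′
... | yes refl = lookup∘update k t true
... | no k≢k′ = trans (lookup∘update′ (k≢k′ ∘ sym) t true) p

⪯-[]≔false : ∀ {n} {y t : Vec Bool n} k → y ⪯ t → lookup y k ≡ false → y ⪯ (t [ k ]≔ false)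
⪯-[]≔false {t = t} k y⪯t yₖ k′ p with k ≟ᶠ k′
... | yes refl = ⊥-elim (true≢false (trans (sym p) yₖ))
... | no k≢k′ = trans (lookup∘update′ (k≢k′ ∘ sym) t false) (y⪯t k′ p)

[]≔true-⪯ : ∀ {n} {y t : Vec Bool n} k → t ⪯ y → lookup y k ≡ true → (t [ k ]≔ true) ⪯ y
[]≔true-⪯ {t = t} k t⪯y yₖ k′ p with k ≟ᶠ k′
... | yes refl = yₖ
... | no k≢k′ = t⪯y k′ (trans (sym (lookup∘update′ (k≢k′ ∘ sym) t true)) p)

⪯-[]≔true⁻ : ∀ {n} {y t : Vec Bool n} k → y ⪯ (t [ k ]≔ true) → lookup y k ≡ false → y ⪯ t
⪯-[]≔true⁻ {t = t} k le yₖ k′ p with k ≟ᶠ k′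
... | yes refl = ⊥-elim (true≢false (trans (sym p) yₖ))
... | no k≢k′ = trans (sym (lookup∘update′ (k≢k′ ∘ sym) t true)) (le k′ p)

[]≔false-[]≔true : ∀ {n} (s : Vec Bool n) k → lookup s k ≡ true → (s [ k ]≔ false) [ k ]≔ true ≡ s
[]≔false-[]≔true s k sₖ = lookup-ext lookups
  where
  lookups : ∀ k′ → lookup ((s [ k ]≔ false) [ k ]≔ true) k′ ≡ lookup s k′
  lookups k′ with k ≟ᶠ k′
  ... | yes refl = trans (lookup∘update k (s [ k ]≔ false) true) (sym sₖ)
  ... | no k≢k′ = trans (lookup∘update′ (k≢k′ ∘ sym) (s [ k ]≔ false) true) (lookup∘update′ (k≢k′ ∘ sym) s false)

#true : ∀ {n} → Vec Bool n → ℕ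
#true [] = 0
#true (true ∷ y) = suc (#true y)
#true (false ∷ y) = #true y

#true-mono : ∀ {n} {y z : Vec Bool n} → y ⪯ z → #true y ≤ #true z
#true-mono {y = []} {[]} le = z≤n
#true-mono {y = true ∷ y} {true ∷ z} le = s≤s (#true-mono {y = y} {z = z} (le ∘ suc))
#true-mono {y = true ∷ y} {false ∷ z} le with () ← le zero refl
#true-mono {y = false ∷ y} {true ∷ z} le = m≤n⇒m≤1+n (#true-mono {y = y} {z = z} (le ∘ suc))
#true-mono {y = false ∷ y} {false ∷ z} le = #true-mono {y = y} {z = z} (le ∘ suc)

#true-strict : ∀ {n} {y z : Vec Bool n} → y ⪯ z → y ≢ z → #true y < #true z
#true-strict {y = []} {[]} le y≢z = ⊥-elim (y≢z refl)
#true-strict {y = true ∷ y} {true ∷ z} le y≢z = s≤s (#true-strict {y = y} {z = z} (le ∘ suc) (y≢z ∘ cong (true ∷_)))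
#true-strict {y = true ∷ y} {false ∷ z} le y≢z with () ← le zero refl
#true-strict {y = false ∷ y} {true ∷ z} le y≢z = s≤s (#true-mono {y = y} {z = z} (le ∘ suc))
#true-strict {y = false ∷ y} {false ∷ z} le y≢z = #true-strict {y = y} {z = z} (le ∘ suc) (y≢z ∘ cong (false ∷_))

module Descent {n} (_≺_ : Vec Bool n → Vec Bool n → Set) (_≺?_ : ∀ x y → Dec (x ≺ y))
  (≺-refl : ∀ {x} → x ≺ x) (≺-trans : ∀ {x y z} → x ≺ y → y ≺ z → x ≺ z)
  (measure : Vec Bool n → ℕ) (measure-strict : ∀ {y z} → y ≺ z → y ≢ z → measure y < measure z) where

  Minimal : (Vec Bool n → Set) → Vec Bool n → Set
  Minimal P t = P t × (∀ y → y ≺ t → P y → y ≡ t)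

  minimal? : ∀ {P} → (∀ x → Dec (P x)) → ∀ t → Dec (Minimal P t)
  minimal? P? t = P? t ×-dec ∀ᵛ? n (λ y → (y ≺? t) →-dec (P? y →-dec (y ≟ᵛ t)))

  minimal-below : ∀ {P} → (∀ x → Dec (P x)) → ∀ z → P z → ∃ λ t → t ≺ z × Minimal P t
  minimal-below {P} P? z p = go (measure z) z ≤-refl p
    where
    go : ∀ bound z → measure z ≤ bound → P z → ∃ λ t → t ≺ z × Minimal P t
    go bound z z≤bound p with minimal? P? z
    ... | yes minimal = z , ≺-refl , minimal
    ... | no ¬minimal with ¬∀ᵛ⇒∃¬ n (λ y → (y ≺? z) →-dec (P? y →-dec (y ≟ᵛ z))) (¬minimal ∘ (p ,_))
    ... | y , ¬y with y ≺? z | P? y | y ≟ᵛ z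
    ... | no y⊀z | _ | _ = ⊥-elim (¬y λ y≺z → ⊥-elim (y⊀z y≺z))
    ... | yes _ | no ¬py | _ = ⊥-elim (¬y λ _ py → ⊥-elim (¬py py))
    ... | yes _ | yes _ | yes y≡z = ⊥-elim (¬y λ _ _ → y≡z)
    ... | yes y≺z | yes py | no y≢z with bound | ≤-trans (measure-strict y≺z y≢z) z≤bound
    ...   | suc bound′ | y<bound = let t , t≺y , minimal = go bound′ y (≤-pred y<bound) py
                                   in t , ≺-trans t≺y y≺z , minimal

#true≤length : ∀ {n} (y : Vec Bool n) → #true y ≤ n
#true≤length [] = z≤n
#true≤length (true ∷ y) = s≤s (#true≤length y)
#true≤length (false ∷ y) = m≤n⇒m≤1+n (#true≤length y)

_⪰_ : ∀ {n} → Vec Bool n → Vec Bool n → Set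
x ⪰ y = y ⪯ x

module Below {n} = Descent {n} _⪯_ _⪯?_ (λ {x} → ⪯-refl {x = x}) (λ {x y z} → ⪯-trans {x = x} {y} {z})
  #true #true-strict
module Above {n} = Descent {n} _⪰_ (λ x y → y ⪯? x) (λ {x} → ⪯-refl {x = x}) (λ {x y z} p q → ⪯-trans {x = z} {y} {x} q p)
  (λ y → n ∸ #true y) (λ {y} {z} z⪯y y≢z → ∸-monoʳ-< (#true-strict z⪯y (y≢z ∘ sym)) (#true≤length y))

-- MinTrue g and MaxFalse g are, definitionally, the Minimal points of g x ≡ true under ⪯ and of
-- g x ≡ false under ⪰.
MinTrue? : ∀ {n} (g : BoolFn n) y → Dec (MinTrue g y)
MinTrue? g = Below.minimal? (λ x → g x ≟ᵇ true)

MaxFalse? : ∀ {n} (g : BoolFn n) y → Dec (MaxFalse g y)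
MaxFalse? g = Above.minimal? (λ x → g x ≟ᵇ false)

minTrue-below : ∀ {n} (g : BoolFn n) z → g z ≡ true → ∃ λ t → t ⪯ z × MinTrue g t
minTrue-below g = Below.minimal-below (λ x → g x ≟ᵇ true)

maxFalse-above : ∀ {n} (g : BoolFn n) z → g z ≡ false → ∃ λ t → z ⪯ t × MaxFalse g t
maxFalse-above g = Above.minimal-below (λ x → g x ≟ᵇ false)

module _ {n} {g : BoolFn n} (g⁺ : Positive g) where

  minTrue-local : ∀ t → g t ≡ true → (∀ k → lookup t k ≡ true → g (t [ k ]≔ false) ≡ false) → MinTrue g t
  minTrue-local t gt local = gt , λ y y⪯t gy → lookup-ext (agree y y⪯t gy)
    where
    agree : ∀ y → y ⪯ t → g y ≡ true → ∀ k → lookup y k ≡ lookup t k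
    agree y y⪯t gy k with lookup y k in yₖ | lookup t k in tₖ
    ... | true | true = refl
    ... | false | false = refl
    ... | true | false = ⊥-elim (true≢false (trans (sym (y⪯t k yₖ)) tₖ))
    ... | false | true = ⊥-elim (true≢false (trans (sym (g⁺ _ _ gy (⪯-[]≔false {y = y} {t = t} k y⪯t yₖ))) (local k tₖ)))

  maxFalse-local : ∀ t → g t ≡ false → (∀ k → lookup t k ≡ false → g (t [ k ]≔ true) ≡ true) → MaxFalse g t
  maxFalse-local t gt local = gt , λ y t⪯y gy → lookup-ext (agree y t⪯y gy)
    where
    agree : ∀ y → t ⪯ y → g y ≡ false → ∀ k → lookup y k ≡ lookup t k
    agree y t⪯y gy k with lookup y k in yₖ | lookup t k in tₖ
    ... | true | true = refl
    ... | false | false = refl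
    ... | false | true = ⊥-elim (true≢false (trans (sym (t⪯y k tₖ)) yₖ))
    ... | true | false = ⊥-elim (true≢false (trans (sym (g⁺ _ _ (local k tₖ) ([]≔true-⪯ {y = y} {t = t} k t⪯y yₖ))) gy))

Pivotal : ∀ {n} → BoolFn n → Fin n → Set
Pivotal g k = ∃ λ z → lookup z k ≡ false × g z ≡ false × g (z [ k ]≔ true) ≡ true

Pivotal? : ∀ {n} (g : BoolFn n) k → Dec (Pivotal g k)
Pivotal? {n} g k = ∃ᵛ? n (λ z → (lookup z k ≟ᵇ false) ×-dec ((g z ≟ᵇ false) ×-dec (g (z [ k ]≔ true) ≟ᵇ true)))

module _ {n} {h : BoolFn n} (h⁺ : Positive h) where

  pivotal⇒minTrue : ∀ k → Pivotal h k → ∃ λ s → MinTrue h s × lookup s k ≡ true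
  pivotal⇒minTrue k (p , pₖ , hp , hp′) with minTrue-below h (p [ k ]≔ true) hp′
  ... | s , s⪯p′ , s-min with lookup s k in sₖ
  ... | true = s , s-min , sₖ
  ... | false = ⊥-elim (true≢false (trans (sym (h⁺ _ _ (proj₁ s-min) (⪯-[]≔true⁻ {y = s} {t = p} k s⪯p′ sₖ))) hp))

  minTrue⇒pivotal : ∀ s k → MinTrue h s → lookup s k ≡ true → Pivotal h k
  minTrue⇒pivotal s k (hs , s-min) sₖ = s [ k ]≔ false , lookup∘update k s false , hs′ , hs″
    where
    hs′ : h (s [ k ]≔ false) ≡ false
    hs′ with h (s [ k ]≔ false) in e
    ... | false = refl
    ... | true = ⊥-elim (true≢false (trans (sym sₖ)
                   (trans (cong (λ v → lookup v k) (sym (s-min _ ([]≔false-⪯ s k) e))) (lookup∘update k s false))))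
    hs″ : h ((s [ k ]≔ false) [ k ]≔ true) ≡ true
    hs″ = subst (λ v → h v ≡ true) (sym ([]≔false-[]≔true s k sₖ)) hs

module _ {m} {g : BoolFn (suc m)} (g⁺ : Positive g) where

  restrict-positive : ∀ i b → Positive (restrict g i b)
  restrict-positive i b y y′ gy y⪯y′ = g⁺ _ _ gy (insertAt-⪯ i y⪯y′ (λ p → p))

  restrict-false⇒true : ∀ i y → restrict g i false y ≡ true → restrict g i true y ≡ true
  restrict-false⇒true i y p = g⁺ _ _ p (insertAt-false-⪯-true y i)

  relevant⇒pivotal : ∀ k → Relevant g k → Pivotal g k
  relevant⇒pivotal k rel with ¬∀ᵛ⇒∃¬ m (λ y → restrict g k false y ≟ᵇ restrict g k true y) rel
  ... | y , differ with g (insertAt y k false) in e₀ | g (insertAt y k true) in e₁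
  ... | true | _ = ⊥-elim (differ (trans (sym (restrict-false⇒true k y e₀)) e₁))
  ... | false | false = ⊥-elim (differ refl)
  ... | false | true = insertAt y k false , insertAt-lookup y k false , e₀ , trans (cong g (insertAt-[]≔ y k false true)) e₁

pivotal⇒relevant : ∀ {m} {g : BoolFn (suc m)} k → Pivotal g k → Relevant g k
pivotal⇒relevant {g = g} k (z , zₖ , gz , gz′) same with insertAt-surjective z k
... | y , b , refl with trans (sym (insertAt-lookup y k b)) zₖ
... | refl = true≢false (trans (sym gz′) (trans (cong g (insertAt-[]≔ y k false true)) (trans (sym (same y)) gz)))

relevant⇔pivotal : ∀ {n} {g : BoolFn n} → Positive g → ∀ k → Relevant g k ⇔ Pivotal g k
relevant⇔pivotal {suc m} g⁺ k = mk⇔ (relevant⇒pivotal g⁺ k) (pivotal⇒relevant k)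

#minTrue #maxFalse #extremal #pivotal : ∀ {n} → BoolFn n → ℕ
#minTrue {n} g = cubeSum n (𝟙 ∘ MinTrue? g)
#maxFalse {n} g = cubeSum n (𝟙 ∘ MaxFalse? g)
#extremal g = #minTrue g + #maxFalse g
#pivotal {n} g = sum (𝟙 ∘ Pivotal? g)

MinTrue∋? : ∀ {n} (g : BoolFn n) k z → Dec (MinTrue g z × lookup z k ≡ true)
MinTrue∋? g k z = MinTrue? g z ×-dec (lookup z k ≟ᵇ true)

#minTrueContaining : ∀ {n} → BoolFn n → Fin n → ℕ
#minTrueContaining {n} g k = cubeSum n (𝟙 ∘ MinTrue∋? g k)

-- Splitting a positive function along a variable

module Along {m} (g : BoolFn (suc m)) (g⁺ : Positive g) (i : Fin (suc m)) where

  g₀ g₁ : BoolFn m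
  g₀ = restrict g i false
  g₁ = restrict g i true

  g₀⁺ : Positive g₀
  g₀⁺ = restrict-positive g⁺ i false
  g₁⁺ : Positive g₁
  g₁⁺ = restrict-positive g⁺ i true

  g₀⇒g₁ : ∀ y → g₀ y ≡ true → g₁ y ≡ true
  g₀⇒g₁ = restrict-false⇒true g⁺ i

  ¬g₁⇒¬g₀ : ∀ y → g₁ y ≡ false → g₀ y ≡ false
  ¬g₁⇒¬g₀ y g₁y = ¬-not λ g₀y → true≢false (trans (sym (g₀⇒g₁ y g₀y)) g₁y)

  MinTrueAt₁ MaxFalseAt₀ : Vec Bool m → Set
  MinTrueAt₁ y = MinTrue g₁ y × g₀ y ≡ false
  MaxFalseAt₀ y = MaxFalse g₀ y × g₁ y ≡ true

  MinTrueAt₁? : ∀ y → Dec (MinTrueAt₁ y)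
  MinTrueAt₁? y = MinTrue? g₁ y ×-dec (g₀ y ≟ᵇ false)
  MaxFalseAt₀? : ∀ y → Dec (MaxFalseAt₀ y)
  MaxFalseAt₀? y = MaxFalse? g₀ y ×-dec (g₁ y ≟ᵇ true)

  #MinTrueAt₁ #MaxFalseAt₀ : ℕ
  #MinTrueAt₁ = cubeSum m (𝟙 ∘ MinTrueAt₁?)
  #MaxFalseAt₀ = cubeSum m (𝟙 ∘ MaxFalseAt₀?)

  minTrue-restricts : ∀ b y → MinTrue g (insertAt y i b) → MinTrue (restrict g i b) y
  minTrue-restricts b y (gt , minimal) =
    gt , λ y′ y′⪯y gy′ → proj₁ (insertAt-injective (minimal _ (insertAt-⪯ i y′⪯y (λ p → p)) gy′))

  maxFalse-restricts : ∀ b y → MaxFalse g (insertAt y i b) → MaxFalse (restrict g i b) y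
  maxFalse-restricts b y (gf , maximal) =
    gf , λ y′ y⪯y′ gy′ → proj₁ (insertAt-injective (maximal _ (insertAt-⪯ i y⪯y′ (λ p → p)) gy′))

  minTrue-insertAt-false : ∀ y → MinTrue g (insertAt y i false) ⇔ MinTrue g₀ y
  minTrue-insertAt-false y = mk⇔ (minTrue-restricts false y) λ (gt , minimal) → gt , below minimal
    where
    below : (∀ y′ → y′ ⪯ y → g₀ y′ ≡ true → y′ ≡ y) →
            ∀ z → z ⪯ insertAt y i false → g z ≡ true → z ≡ insertAt y i false
    below minimal z z⪯ gz with insertAt-surjective z i
    ... | y′ , b , refl with insertAt-⪯⁻ i z⪯
    ... | y′⪯y , b⇒false with b
    ... | true = ⊥-elim (true≢false (sym (b⇒false refl)))
    ... | false = cong (λ v → insertAt v i false) (minimal y′ y′⪯y gz)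

  minTrue-insertAt-true : ∀ y → MinTrue g (insertAt y i true) ⇔ MinTrueAt₁ y
  minTrue-insertAt-true y = mk⇔
    (λ min → minTrue-restricts true y min , g₀-false min)
    (λ ((gt , minimal) , g₀y) → gt , below minimal g₀y)
    where
    g₀-false : MinTrue g (insertAt y i true) → g₀ y ≡ false
    g₀-false (_ , minimal) with g₀ y in e
    ... | false = refl
    ... | true = ⊥-elim (true≢false (sym (proj₂ (insertAt-injective (minimal _ (insertAt-false-⪯-true y i) e)))))
    below : (∀ y′ → y′ ⪯ y → g₁ y′ ≡ true → y′ ≡ y) → g₀ y ≡ false →
            ∀ z → z ⪯ insertAt y i true → g z ≡ true → z ≡ insertAt y i true
    below minimal g₀y z z⪯ gz with insertAt-surjective z i
    ... | y′ , b , refl with insertAt-⪯⁻ i z⪯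
    ... | y′⪯y , _ with b
    ... | false = ⊥-elim (true≢false (trans (sym (g₀⁺ y′ y gz y′⪯y)) g₀y))
    ... | true = cong (λ v → insertAt v i true) (minimal y′ y′⪯y gz)

  maxFalse-insertAt-false : ∀ y → MaxFalse g (insertAt y i false) ⇔ MaxFalseAt₀ y
  maxFalse-insertAt-false y = mk⇔
    (λ max → maxFalse-restricts false y max , g₁-true max)
    (λ ((gf , maximal) , g₁y) → gf , above maximal g₁y)
    where
    g₁-true : MaxFalse g (insertAt y i false) → g₁ y ≡ true
    g₁-true (_ , maximal) with g₁ y in e
    ... | true = refl
    ... | false = ⊥-elim (true≢false (proj₂ (insertAt-injective (maximal _ (insertAt-false-⪯-true y i) e))))
    above : (∀ y′ → y ⪯ y′ → g₀ y′ ≡ false → y′ ≡ y) → g₁ y ≡ true →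
            ∀ z → insertAt y i false ⪯ z → g z ≡ false → z ≡ insertAt y i false
    above maximal g₁y z ⪯z gz with insertAt-surjective z i
    ... | y′ , b , refl with insertAt-⪯⁻ i ⪯z
    ... | y⪯y′ , _ with b
    ... | true = ⊥-elim (true≢false (trans (sym (g₁⁺ y y′ g₁y y⪯y′)) gz))
    ... | false = cong (λ v → insertAt v i false) (maximal y′ y⪯y′ gz)

  maxFalse-insertAt-true : ∀ y → MaxFalse g (insertAt y i true) ⇔ MaxFalse g₁ y
  maxFalse-insertAt-true y = mk⇔ (maxFalse-restricts true y) λ (gf , maximal) → gf , above maximal
    where
    above : (∀ y′ → y ⪯ y′ → g₁ y′ ≡ false → y′ ≡ y) →
            ∀ z → insertAt y i true ⪯ z → g z ≡ false → z ≡ insertAt y i true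
    above maximal z ⪯z gz with insertAt-surjective z i
    ... | y′ , b , refl with insertAt-⪯⁻ i ⪯z
    ... | y⪯y′ , true⇒b with b | true⇒b refl
    ... | true | _ = cong (λ v → insertAt v i true) (maximal y′ y⪯y′ gz)

  pivotal-punchIn : ∀ j → Pivotal g (punchIn i j) ⇔ (Pivotal g₀ j ⊎ Pivotal g₁ j)
  pivotal-punchIn j = mk⇔ to from
    where
    to : Pivotal g (punchIn i j) → Pivotal g₀ j ⊎ Pivotal g₁ j
    to (z , zⱼ , gz , gz′) with insertAt-surjective z i
    ... | y , false , refl = inj₁ (y , trans (sym (insertAt-punchIn y i false j)) zⱼ , gz ,
                                   trans (cong g (sym (insertAt-[]≔-punchIn y i false j true))) gz′)
    ... | y , true , refl = inj₂ (y , trans (sym (insertAt-punchIn y i true j)) zⱼ , gz ,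
                                  trans (cong g (sym (insertAt-[]≔-punchIn y i true j true))) gz′)
    lift : ∀ b → Pivotal (restrict g i b) j → Pivotal g (punchIn i j)
    lift b (y , yⱼ , gy , gy′) = insertAt y i b , trans (insertAt-punchIn y i b j) yⱼ , gy ,
                                 trans (cong g (insertAt-[]≔-punchIn y i b j true)) gy′
    from : Pivotal g₀ j ⊎ Pivotal g₁ j → Pivotal g (punchIn i j)
    from (inj₁ p) = lift false p
    from (inj₂ p) = lift true p

  pivotal-self : Pivotal g i ⇔ ∃ λ y → g₀ y ≡ false × g₁ y ≡ true
  pivotal-self = mk⇔ to λ (y , g₀y , g₁y) →
    insertAt y i false , insertAt-lookup y i false , g₀y , trans (cong g (insertAt-[]≔ y i false true)) g₁y
    where
    to : Pivotal g i → ∃ λ y → g₀ y ≡ false × g₁ y ≡ true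
    to (z , zᵢ , gz , gz′) with insertAt-surjective z i
    ... | y , b , refl with trans (sym (insertAt-lookup y i b)) zᵢ
    ... | refl = y , gz , trans (cong g (sym (insertAt-[]≔ y i false true))) gz′

  #minTrue-split : #minTrue g ≡ #minTrue g₀ + #MinTrueAt₁
  #minTrue-split = trans (cubeSum-insertAt m i (𝟙 ∘ MinTrue? g))
    (cong₂ _+_ (cubeSum-cong λ y → 𝟙-cong-⇔ (MinTrue? g _) (MinTrue? g₀ y) (minTrue-insertAt-false y))
               (cubeSum-cong λ y → 𝟙-cong-⇔ (MinTrue? g _) (MinTrueAt₁? y) (minTrue-insertAt-true y)))

  #maxFalse-split : #maxFalse g ≡ #MaxFalseAt₀ + #maxFalse g₁
  #maxFalse-split = trans (cubeSum-insertAt m i (𝟙 ∘ MaxFalse? g))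
    (cong₂ _+_ (cubeSum-cong λ y → 𝟙-cong-⇔ (MaxFalse? g _) (MaxFalseAt₀? y) (maxFalse-insertAt-false y))
               (cubeSum-cong λ y → 𝟙-cong-⇔ (MaxFalse? g _) (MaxFalse? g₁ y) (maxFalse-insertAt-true y)))

  #extremal-split : #extremal g ≡ (#minTrue g₀ + #MinTrueAt₁) + (#MaxFalseAt₀ + #maxFalse g₁)
  #extremal-split = cong₂ _+_ #minTrue-split #maxFalse-split

  #pivotal-split : #pivotal g ≡ 𝟙 (Pivotal? g i) + sum (λ j → 𝟙 (Pivotal? g₀ j ⊎-dec Pivotal? g₁ j))
  #pivotal-split = trans (sum-remove {i = i} (𝟙 ∘ Pivotal? g))
    (cong (𝟙 (Pivotal? g i) +_) (sum-cong-≗ λ j →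
      𝟙-cong-⇔ (Pivotal? g _) (Pivotal? g₀ j ⊎-dec Pivotal? g₁ j) (pivotal-punchIn j)))

  MaxFalse₁∖₀? : ∀ y → Dec (MaxFalse g₁ y × ¬ MaxFalse g₀ y)
  MaxFalse₁∖₀? y = MaxFalse? g₁ y ×-dec ¬? (MaxFalse? g₀ y)
  MinTrue₀∖₁? : ∀ y → Dec (MinTrue g₀ y × ¬ MinTrue g₁ y)
  MinTrue₀∖₁? y = MinTrue? g₀ y ×-dec ¬? (MinTrue? g₁ y)

  #MaxFalse₁∖₀ #MinTrue₀∖₁ : ℕ
  #MaxFalse₁∖₀ = cubeSum m (𝟙 ∘ MaxFalse₁∖₀?)
  #MinTrue₀∖₁ = cubeSum m (𝟙 ∘ MinTrue₀∖₁?)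

  -- A maximal false point of g₀ that is not one of g (at x_i = 0) is one of g₁.
  #maxFalse₀-cover : #maxFalse g₀ + #MaxFalse₁∖₀ ≤ #MaxFalseAt₀ + #maxFalse g₁
  #maxFalse₀-cover = begin
    #maxFalse g₀ + #MaxFalse₁∖₀
      ≡⟨ cubeSum-+ (𝟙 ∘ MaxFalse? g₀) (𝟙 ∘ MaxFalse₁∖₀?) ⟨
    cubeSum m (λ y → 𝟙 (MaxFalse? g₀ y) + 𝟙 (MaxFalse₁∖₀? y))
      ≤⟨ cubeSum-mono (λ y → 𝟙-cover (MaxFalse? g₀ y) (MaxFalseAt₀? y) (MaxFalse? g₁ y) (maxFalse₁ y)) ⟩
    cubeSum m (λ y → 𝟙 (MaxFalseAt₀? y) + 𝟙 (MaxFalse? g₁ y))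
      ≡⟨ cubeSum-+ (𝟙 ∘ MaxFalseAt₀?) (𝟙 ∘ MaxFalse? g₁) ⟩
    #MaxFalseAt₀ + #maxFalse g₁ ∎
    where
    open ≤-Reasoning
    maxFalse₁ : ∀ y → MaxFalse g₀ y → ¬ MaxFalseAt₀ y → MaxFalse g₁ y
    maxFalse₁ y (g₀y , maximal) ¬at₀ with g₁ y
    ... | true = ⊥-elim (¬at₀ ((g₀y , maximal) , refl))
    ... | false = refl , λ y′ y⪯y′ g₁y′ → maximal y′ y⪯y′ (¬g₁⇒¬g₀ y′ g₁y′)

  #minTrue₁-cover : #minTrue g₁ + #MinTrue₀∖₁ ≤ #minTrue g₀ + #MinTrueAt₁
  #minTrue₁-cover = begin
    #minTrue g₁ + #MinTrue₀∖₁
      ≡⟨ cubeSum-+ (𝟙 ∘ MinTrue? g₁) (𝟙 ∘ MinTrue₀∖₁?) ⟨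
    cubeSum m (λ y → 𝟙 (MinTrue? g₁ y) + 𝟙 (MinTrue₀∖₁? y))
      ≤⟨ cubeSum-mono (λ y → 𝟙-cover (MinTrue? g₁ y) (MinTrueAt₁? y) (MinTrue? g₀ y) (minTrue₀ y)) ⟩
    cubeSum m (λ y → 𝟙 (MinTrueAt₁? y) + 𝟙 (MinTrue? g₀ y))
      ≡⟨ trans (cubeSum-+ (𝟙 ∘ MinTrueAt₁?) (𝟙 ∘ MinTrue? g₀)) (+-comm #MinTrueAt₁ (#minTrue g₀)) ⟩
    #minTrue g₀ + #MinTrueAt₁ ∎
    where
    open ≤-Reasoning
    minTrue₀ : ∀ y → MinTrue g₁ y → ¬ MinTrueAt₁ y → MinTrue g₀ y
    minTrue₀ y (g₁y , minimal) ¬at₁ with g₀ y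
    ... | false = ⊥-elim (¬at₁ ((g₁y , minimal) , refl))
    ... | true = refl , λ y′ y′⪯y g₀y′ → minimal y′ y′⪯y (g₀⇒g₁ y′ g₀y′)

  #extremal₀-bound : #extremal g₀ + (#MinTrueAt₁ + #MaxFalse₁∖₀) ≤ #extremal g
  #extremal₀-bound = begin
    (#minTrue g₀ + #maxFalse g₀) + (#MinTrueAt₁ + #MaxFalse₁∖₀)
      ≡⟨ +-interchange (#minTrue g₀) (#maxFalse g₀) #MinTrueAt₁ #MaxFalse₁∖₀ ⟩
    (#minTrue g₀ + #MinTrueAt₁) + (#maxFalse g₀ + #MaxFalse₁∖₀)
      ≤⟨ +-monoʳ-≤ (#minTrue g₀ + #MinTrueAt₁) #maxFalse₀-cover ⟩
    (#minTrue g₀ + #MinTrueAt₁) + (#MaxFalseAt₀ + #maxFalse g₁)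
      ≡⟨ #extremal-split ⟨
    #extremal g ∎
    where open ≤-Reasoning

  #extremal₁-bound : #extremal g₁ + (#MaxFalseAt₀ + #MinTrue₀∖₁) ≤ #extremal g
  #extremal₁-bound = begin
    (#minTrue g₁ + #maxFalse g₁) + (#MaxFalseAt₀ + #MinTrue₀∖₁)
      ≡⟨ +-interchange (#minTrue g₁) (#maxFalse g₁) #MaxFalseAt₀ #MinTrue₀∖₁ ⟩
    (#minTrue g₁ + #MaxFalseAt₀) + (#maxFalse g₁ + #MinTrue₀∖₁)
      ≡⟨ cong ((#minTrue g₁ + #MaxFalseAt₀) +_) (+-comm (#maxFalse g₁) #MinTrue₀∖₁) ⟩
    (#minTrue g₁ + #MaxFalseAt₀) + (#MinTrue₀∖₁ + #maxFalse g₁)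
      ≡⟨ +-interchange (#minTrue g₁) #MaxFalseAt₀ #MinTrue₀∖₁ (#maxFalse g₁) ⟩
    (#minTrue g₁ + #MinTrue₀∖₁) + (#MaxFalseAt₀ + #maxFalse g₁)
      ≤⟨ +-monoˡ-≤ (#MaxFalseAt₀ + #maxFalse g₁) #minTrue₁-cover ⟩
    (#minTrue g₀ + #MinTrueAt₁) + (#MaxFalseAt₀ + #maxFalse g₁)
      ≡⟨ #extremal-split ⟨
    #extremal g ∎
    where open ≤-Reasoning

  pivotal⇒MinTrueAt₁ : Pivotal g i → ∃ MinTrueAt₁
  pivotal⇒MinTrueAt₁ piv with Equivalence.to pivotal-self piv
  ... | y , g₀y , g₁y with minTrue-below g₁ y g₁y
  ... | t , t⪯y , t-min = t , t-min , ¬-not λ g₀t → true≢false (trans (sym (g₀⁺ t y g₀t t⪯y)) g₀y)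

  pivotal⇒MaxFalseAt₀ : Pivotal g i → ∃ MaxFalseAt₀
  pivotal⇒MaxFalseAt₀ piv with Equivalence.to pivotal-self piv
  ... | y , g₀y , g₁y with maxFalse-above g₀ y g₀y
  ... | t , y⪯t , t-max = t , t-max , g₁⁺ y t g₁y y⪯t

  pivotal⇒#MinTrueAt₁≥1 : Pivotal g i → 1 ≤ #MinTrueAt₁
  pivotal⇒#MinTrueAt₁≥1 piv = let t , at₁ = pivotal⇒MinTrueAt₁ piv in
    ≤-trans (≤-reflexive (sym (𝟙-yes (MinTrueAt₁? t) at₁))) (term≤cubeSum (𝟙 ∘ MinTrueAt₁?) t)

  pivotal⇒#MaxFalseAt₀≥1 : Pivotal g i → 1 ≤ #MaxFalseAt₀
  pivotal⇒#MaxFalseAt₀≥1 piv = let t , at₀ = pivotal⇒MaxFalseAt₀ piv in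
    ≤-trans (≤-reflexive (sym (𝟙-yes (MaxFalseAt₀? t) at₀))) (term≤cubeSum (𝟙 ∘ MaxFalseAt₀?) t)

  #pivotal≤suc-#pivotal₀ : (∀ j → Pivotal g₁ j → Pivotal g₀ j) → #pivotal g ≤ suc (#pivotal g₀)
  #pivotal≤suc-#pivotal₀ ₁⊆₀ = ≤-trans (≤-reflexive #pivotal-split) (+-mono-≤ (𝟙≤1 (Pivotal? g i)) (sum-mono bound))
    where
    bound : ∀ j → 𝟙 (Pivotal? g₀ j ⊎-dec Pivotal? g₁ j) ≤ 𝟙 (Pivotal? g₀ j)
    bound j = 𝟙-mono (Pivotal? g₀ j ⊎-dec Pivotal? g₁ j) (Pivotal? g₀ j) λ { (inj₁ p) → p ; (inj₂ p) → ₁⊆₀ j p }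

  #pivotal≤suc-#pivotal₁ : (∀ j → Pivotal g₀ j → Pivotal g₁ j) → #pivotal g ≤ suc (#pivotal g₁)
  #pivotal≤suc-#pivotal₁ ₀⊆₁ = ≤-trans (≤-reflexive #pivotal-split) (+-mono-≤ (𝟙≤1 (Pivotal? g i)) (sum-mono bound))
    where
    bound : ∀ j → 𝟙 (Pivotal? g₀ j ⊎-dec Pivotal? g₁ j) ≤ 𝟙 (Pivotal? g₁ j)
    bound j = 𝟙-mono (Pivotal? g₀ j ⊎-dec Pivotal? g₁ j) (Pivotal? g₁ j) λ { (inj₁ p) → ₀⊆₁ j p ; (inj₂ p) → p }

  MinTrueAt₁∋? : ∀ j y → Dec (MinTrueAt₁ y × lookup y j ≡ true)
  MinTrueAt₁∋? j y = MinTrueAt₁? y ×-dec (lookup y j ≟ᵇ true)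

  #minTrueContaining-self : #minTrueContaining g i ≡ #MinTrueAt₁
  #minTrueContaining-self = trans (cubeSum-insertAt m i (𝟙 ∘ MinTrue∋? g i)) (cong₂ _+_ none (cubeSum-cong at₁))
    where
    none : cubeSum m (λ y → 𝟙 (MinTrue∋? g i (insertAt y i false))) ≡ 0
    none = cubeSum-zero {m} λ y → 𝟙-no (MinTrue∋? g i (insertAt y i false)) λ (_ , e) →
      true≢false (trans (sym e) (insertAt-lookup y i false))
    at₁ : ∀ y → 𝟙 (MinTrue∋? g i (insertAt y i true)) ≡ 𝟙 (MinTrueAt₁? y)
    at₁ y = 𝟙-cong (MinTrue∋? g i (insertAt y i true)) (MinTrueAt₁? y) (Equivalence.to (minTrue-insertAt-true y) ∘ proj₁)
                     λ at₁ → Equivalence.from (minTrue-insertAt-true y) at₁ , insertAt-lookup y i true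

  #minTrueContaining-punchIn : ∀ j → ¬ Pivotal g₀ j →
                               #minTrueContaining g (punchIn i j) ≡ cubeSum m (𝟙 ∘ MinTrueAt₁∋? j)
  #minTrueContaining-punchIn j ¬piv₀ =
    trans (cubeSum-insertAt m i (𝟙 ∘ MinTrue∋? g (punchIn i j))) (cong₂ _+_ none (cubeSum-cong at₁))
    where
    none : cubeSum m (λ y → 𝟙 (MinTrue∋? g (punchIn i j) (insertAt y i false))) ≡ 0
    none = cubeSum-zero {m} λ y → 𝟙-no (MinTrue∋? g (punchIn i j) (insertAt y i false)) λ (min , e) →
      ¬piv₀ (minTrue⇒pivotal g₀⁺ y j (Equivalence.to (minTrue-insertAt-false y) min) (trans (sym (insertAt-punchIn y i false j)) e))
    at₁ : ∀ y → 𝟙 (MinTrue∋? g (punchIn i j) (insertAt y i true)) ≡ 𝟙 (MinTrueAt₁∋? j y)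
    at₁ y = 𝟙-cong (MinTrue∋? g (punchIn i j) (insertAt y i true)) (MinTrueAt₁∋? j y)
      (λ (min , e) → Equivalence.to (minTrue-insertAt-true y) min , trans (sym (insertAt-punchIn y i true j)) e)
      (λ (at₁ , e) → Equivalence.from (minTrue-insertAt-true y) at₁ , trans (insertAt-punchIn y i true j) e)

  -- The witness: a minimal true point of g₀ with x_k switched off stays false for g₁.
  pivotal₀⇒pivotal₁ : ∀ j → ¬ Pivotal g₀ j → (∀ y → MinTrueAt₁ y → lookup y j ≡ true) →
                      ∀ k → Pivotal g₀ k → Pivotal g₁ k
  pivotal₀⇒pivotal₁ j ¬piv₀ at₁∋j k piv₀ with pivotal⇒minTrue g₀⁺ k piv₀
  ... | s , s-min , sₖ = s [ k ]≔ false , lookup∘update k s false , g₁s′ ,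
                         subst (λ v → g₁ v ≡ true) (sym ([]≔false-[]≔true s k sₖ)) (g₀⇒g₁ s (proj₁ s-min))
    where
    g₁s′ : g₁ (s [ k ]≔ false) ≡ false
    g₁s′ with g₁ (s [ k ]≔ false) in e
    ... | false = refl
    ... | true with minTrue-below g₁ _ e
    ... | t , t⪯s′ , t-min with g₀ t in g₀t
    ... | true = ⊥-elim (true≢false (trans (sym sₖ)
                   (trans (cong (λ v → lookup v k) (sym (proj₂ s-min _ ([]≔false-⪯ s k) (g₀⁺ t (s [ k ]≔ false) g₀t t⪯s′))))
                          (lookup∘update k s false))))
    ... | false = ⊥-elim (¬piv₀ (minTrue⇒pivotal g₀⁺ s j s-min ([]≔false-⪯ s k j (t⪯s′ j (at₁∋j t (t-min , g₀t))))))

  nested-if-fewest : (∀ k → Pivotal g k → #minTrueContaining g i ≤ #minTrueContaining g k) →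
                     (∀ j → Pivotal g₁ j → Pivotal g₀ j) ⊎ (∀ j → Pivotal g₀ j → Pivotal g₁ j)
  nested-if-fewest fewest with all? (λ j → Pivotal? g₁ j →-dec Pivotal? g₀ j)
  ... | yes ₁⊆₀ = inj₁ ₁⊆₀
  ... | no ¬₁⊆₀ with ¬∀⟶∃¬ m _ (λ j → Pivotal? g₁ j →-dec Pivotal? g₀ j) ¬₁⊆₀
  ... | j , ¬j with Pivotal? g₁ j | Pivotal? g₀ j
  ... | no ¬piv₁ | _ = ⊥-elim (¬j (⊥-elim ∘ ¬piv₁))
  ... | yes _ | yes piv₀ = ⊥-elim (¬j (λ _ → piv₀))
  ... | yes piv₁ | no ¬piv₀ = inj₂ (pivotal₀⇒pivotal₁ j ¬piv₀ at₁∋j)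
    where
    count≤ : #MinTrueAt₁ ≤ cubeSum m (𝟙 ∘ MinTrueAt₁∋? j)
    count≤ = subst₂ _≤_ #minTrueContaining-self (#minTrueContaining-punchIn j ¬piv₀)
                    (fewest (punchIn i j) (Equivalence.from (pivotal-punchIn j) (inj₂ piv₁)))
    at₁∋j : ∀ y → MinTrueAt₁ y → lookup y j ≡ true
    at₁∋j y at₁ = proj₂ (𝟙≡1⇒ (MinTrueAt₁∋? j y)
      (trans (cubeSum-≤-tight m (𝟙 ∘ MinTrueAt₁∋? j) (𝟙 ∘ MinTrueAt₁?)
                              (λ y → 𝟙-mono (MinTrueAt₁∋? j y) (MinTrueAt₁? y) proj₁) count≤ y)
             (𝟙-yes (MinTrueAt₁? y) at₁)))

  #extremal₀<#extremal : Pivotal g i → #extremal g₀ < #extremal g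
  #extremal₀<#extremal piv = begin-strict
    #extremal g₀                                  <⟨ m<m+n (#extremal g₀) (pivotal⇒#MinTrueAt₁≥1 piv) ⟩
    #extremal g₀ + #MinTrueAt₁                    ≤⟨ +-monoʳ-≤ (#extremal g₀) (m≤m+n #MinTrueAt₁ #MaxFalse₁∖₀) ⟩
    #extremal g₀ + (#MinTrueAt₁ + #MaxFalse₁∖₀)   ≤⟨ #extremal₀-bound ⟩
    #extremal g ∎
    where open ≤-Reasoning

  #extremal₁<#extremal : Pivotal g i → #extremal g₁ < #extremal g
  #extremal₁<#extremal piv = begin-strict
    #extremal g₁                                  <⟨ m<m+n (#extremal g₁) (pivotal⇒#MaxFalseAt₀≥1 piv) ⟩
    #extremal g₁ + #MaxFalseAt₀                   ≤⟨ +-monoʳ-≤ (#extremal g₁) (m≤m+n #MaxFalseAt₀ #MinTrue₀∖₁) ⟩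
    #extremal g₁ + (#MaxFalseAt₀ + #MinTrue₀∖₁)   ≤⟨ #extremal₁-bound ⟩
    #extremal g ∎
    where open ≤-Reasoning

-- The lower bound

minimiser : ∀ n {P : Fin n → Set} (P? : ∀ k → Dec (P k)) (f : Fin n → ℕ) → ∃ P →
            ∃ λ i → P i × ∀ k → P k → f i ≤ f k
minimiser n {P} P? f (k , pk) = go (f k) k ≤-refl pk
  where
  go : ∀ bound k → f k ≤ bound → P k → ∃ λ i → P i × ∀ k → P k → f i ≤ f k
  go bound k fk≤bound pk with any? (λ k′ → P? k′ ×-dec (f k′ <? f k))
  ... | no ¬smaller = k , pk , λ k′ pk′ → ≮⇒≥ (λ f<f → ¬smaller (k′ , pk′ , f<f))
  ... | yes (k′ , pk′ , f<f) with bound | ≤-trans f<f fk≤bound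
  ...   | suc bound′ | fk′<bound = go bound′ k′ (≤-pred fk′<bound) pk′

#extremal≥1 : ∀ {n} (g : BoolFn n) → 1 ≤ #extremal g
#extremal≥1 {n} g with g (replicate n true) in e
... | true = let t , _ , t-min = minTrue-below g _ e in
  ≤-trans (≤-trans (≤-reflexive (sym (𝟙-yes (MinTrue? g t) t-min))) (term≤cubeSum (𝟙 ∘ MinTrue? g) t)) (m≤m+n _ _)
... | false = let t , _ , t-max = maxFalse-above g _ e in
  ≤-trans (≤-trans (≤-reflexive (sym (𝟙-yes (MaxFalse? g t) t-max))) (term≤cubeSum (𝟙 ∘ MaxFalse? g) t)) (m≤n+m _ _)

#pivotal≡0 : ∀ {n} (g : BoolFn n) → ¬ ∃ (Pivotal g) → #pivotal g ≡ 0
#pivotal≡0 {n} g ¬∃ = trans (sum-cong-≗ λ k → 𝟙-no (Pivotal? g k) (¬∃ ∘ (k ,_))) (sum-replicate-zero n)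

NestedRestrictions : ∀ {m} → BoolFn (suc m) → Fin (suc m) → Set
NestedRestrictions g i = (∀ j → Pivotal (restrict g i true) j → Pivotal (restrict g i false) j)
           ⊎ (∀ j → Pivotal (restrict g i false) j → Pivotal (restrict g i true) j)

splitting-variable : ∀ {m} (g : BoolFn (suc m)) → Positive g → ∃ (Pivotal g) → ∃ λ i → Pivotal g i × NestedRestrictions g i
splitting-variable {m} g g⁺ ∃piv with minimiser (suc m) (Pivotal? g) (#minTrueContaining g) ∃piv
... | i , piv , fewest = i , piv , Along.nested-if-fewest g g⁺ i fewest

#pivotal<#extremal : ∀ n (g : BoolFn n) → Positive g → #pivotal g < #extremal g
#pivotal<#extremal zero g g⁺ = #extremal≥1 g
#pivotal<#extremal (suc m) g g⁺ with any? (Pivotal? g)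
... | no ¬∃ = subst (_< #extremal g) (sym (#pivotal≡0 g ¬∃)) (#extremal≥1 g)
... | yes ∃piv = split (splitting-variable g g⁺ ∃piv)
  where
  split : ∃ (λ i → Pivotal g i × NestedRestrictions g i) → #pivotal g < #extremal g
  split (i , piv , inj₁ ₁⊆₀) =
    ≤-trans (s≤s (#pivotal≤suc-#pivotal₀ ₁⊆₀)) (≤-trans (s≤s (#pivotal<#extremal m g₀ g₀⁺)) (#extremal₀<#extremal piv))
    where open Along g g⁺ i
  split (i , piv , inj₂ ₀⊆₁) =
    ≤-trans (s≤s (#pivotal≤suc-#pivotal₁ ₀⊆₁)) (≤-trans (s≤s (#pivotal<#extremal m g₁ g₁⁺)) (#extremal₁<#extremal piv))
    where open Along g g⁺ i

-- Equality forces a canalyzing variable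

Forces : ∀ {n} → BoolFn n → Fin n → Bool → Bool → Set
Forces g k b c = ∀ z → lookup z k ≡ b → g z ≡ c

Forcing : ∀ {n} → BoolFn n → Set
Forcing g = ∃ λ k → ∃ λ b → ∃ λ c → Forces g k b c

no-pivotal⇒constant : ∀ {n} (g : BoolFn n) → Positive g → ¬ ∃ (Pivotal g) → Constant g
no-pivotal⇒constant {n} g g⁺ ¬∃ with g (replicate n false) in e₀ | g (replicate n true) in e₁
... | true | _ = true , λ z → g⁺ _ z e₀ (replicate-false-⪯ z)
... | false | false = false , λ z → ¬-not λ gz → true≢false (trans (sym (g⁺ z _ gz (⪯-replicate-true z))) e₁)
... | false | true = ⊥-elim (¬∃ (climb n g e₀ e₁))
  where
  climb : ∀ n (h : BoolFn n) → h (replicate n false) ≡ false → h (replicate n true) ≡ true → ∃ (Pivotal h)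
  climb zero h h0 h1 = ⊥-elim (true≢false (trans (sym h1) h0))
  climb (suc n) h h0 h1 with h (true ∷ replicate n false) in e
  ... | true = zero , false ∷ replicate n false , refl , h0 , e
  ... | false = let k , z , zₖ , hz , hz′ = climb n (h ∘ (true ∷_)) e h1 in suc k , true ∷ z , zₖ , hz , hz′

forces-everywhere-true : ∀ {n} {h : BoolFn n} → Positive h → ∀ w → Forces h w false true → ∀ y → h y ≡ true
forces-everywhere-true h⁺ w forces y = h⁺ (y [ w ]≔ false) y (forces _ (lookup∘update w y false)) ([]≔false-⪯ y w)

forces-everywhere-false : ∀ {n} {h : BoolFn n} → Positive h → ∀ w → Forces h w true false → ∀ y → h y ≡ false
forces-everywhere-false h⁺ w forces y =
  ¬-not λ hy → true≢false (trans (sym (h⁺ y (y [ w ]≔ true) hy (⪯-[]≔true y w))) (forces _ (lookup∘update w y true)))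

module Lift {m} (g : BoolFn (suc m)) (g⁺ : Positive g) (i : Fin (suc m)) where
  open Along g g⁺ i public

  g-true-if-g₀ : ∀ y b → g₀ y ≡ true → g (insertAt y i b) ≡ true
  g-true-if-g₀ y b g₀y = g⁺ _ _ g₀y (insertAt-⪯ i (⪯-refl {x = y}) (λ ()))

  g-false-if-g₁ : ∀ y b → g₁ y ≡ false → g (insertAt y i b) ≡ false
  g-false-if-g₁ y b g₁y = ¬-not λ gy → true≢false (trans (sym (g⁺ _ _ gy (insertAt-⪯ i (⪯-refl {x = y}) (λ _ → refl)))) g₁y)

  constant-if-g₀-true : (∀ y → g₀ y ≡ true) → Constant g
  constant-if-g₀-true g₀-true = true , λ z → let y , b , z≡ = insertAt-surjective z i in
    subst (λ v → g v ≡ true) (sym z≡) (g-true-if-g₀ y b (g₀-true y))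

  constant-if-g₁-false : (∀ y → g₁ y ≡ false) → Constant g
  constant-if-g₁-false g₁-false = false , λ z → let y , b , z≡ = insertAt-surjective z i in
    subst (λ v → g v ≡ false) (sym z≡) (g-false-if-g₁ y b (g₁-false y))

  forces-if-restriction-constant : ∀ b c → (∀ y → restrict g i b y ≡ c) → Forces g i b c
  forces-if-restriction-constant b c const z zᵢ with insertAt-surjective z i
  ... | y , b′ , refl with trans (sym (insertAt-lookup y i b′)) zᵢ
  ... | refl = const y

  forces-true-lifts : ∀ w → Forces g₀ w true true → Forces g (punchIn i w) true true
  forces-true-lifts w forces z z_w with insertAt-surjective z i
  ... | y , b , refl = g-true-if-g₀ y b (forces y (trans (sym (insertAt-punchIn y i b w)) z_w))

  forces-false-lifts : ∀ w → Forces g₁ w false false → Forces g (punchIn i w) false false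
  forces-false-lifts w forces z z_w with insertAt-surjective z i
  ... | y , b , refl = g-false-if-g₁ y b (forces y (trans (sym (insertAt-punchIn y i b w)) z_w))

module _ {n} {h : BoolFn n} (h⁺ : Positive h) where

  forces-if-false-below-coatom : ∀ v → h (replicate n true [ v ]≔ false) ≡ false → Forces h v false false
  forces-if-false-below-coatom v h-coatom z zᵥ = ¬-not λ hz → true≢false (trans (sym (h⁺ z _ hz z⪯)) h-coatom)
    where
    z⪯ : z ⪯ (replicate n true [ v ]≔ false)
    z⪯ k zₖ with v ≟ᶠ k
    ... | yes refl = ⊥-elim (true≢false (trans (sym zₖ) zᵥ))
    ... | no v≢k = trans (lookup∘update′ (v≢k ∘ sym) (replicate n true) false) (lookup-replicate k true)

  forces-if-true-above-atom : ∀ v → h (replicate n false [ v ]≔ true) ≡ true → Forces h v true true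
  forces-if-true-above-atom v h-atom z zᵥ = h⁺ _ z h-atom ⪯z
    where
    ⪯z : (replicate n false [ v ]≔ true) ⪯ z
    ⪯z k e with v ≟ᶠ k
    ... | yes refl = zᵥ
    ... | no v≢k = ⊥-elim (true≢false (trans (sym e) (trans (lookup∘update′ (v≢k ∘ sym) (replicate n false) true)
                                                              (lookup-replicate k false))))

  everywhere-true-if-true-at-zero : ∀ t → h t ≡ true → (∀ k → lookup t k ≢ true) → ∀ y → h y ≡ true
  everywhere-true-if-true-at-zero t ht t≡0 y = h⁺ t y ht (λ k tₖ → ⊥-elim (t≡0 k tₖ))

  everywhere-false-if-false-at-one : ∀ t → h t ≡ false → (∀ k → lookup t k ≢ false) → ∀ y → h y ≡ false
  everywhere-false-if-false-at-one t ht t≡1 y =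
    ¬-not λ hy → true≢false (trans (sym (h⁺ y t hy (λ k _ → ¬-not (t≡1 k)))) ht)

squeeze : ∀ {E K E₀ K₀ Y} → E₀ + Y ≤ E → E ≡ suc K → K ≤ suc K₀ → K₀ < E₀ → 1 ≤ Y → Y ≤ 1 × E₀ ≡ suc K₀
squeeze {E} {K} {E₀} {K₀} {Y} E₀+Y≤E E≡ K≤ K₀< 1≤Y = +-cancelˡ-≤ E₀ Y 1 E₀+Y≤E₀+1 , ≤-antisym E₀≤ K₀<
  where
  E₀+Y≤suc-suc-K₀ : E₀ + Y ≤ suc (suc K₀)
  E₀+Y≤suc-suc-K₀ = ≤-trans E₀+Y≤E (≤-trans (≤-reflexive E≡) (s≤s K≤))
  E₀+Y≤E₀+1 : E₀ + Y ≤ E₀ + 1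
  E₀+Y≤E₀+1 = ≤-trans E₀+Y≤suc-suc-K₀ (≤-trans (s≤s K₀<) (≤-reflexive (+-comm 1 E₀)))
  E₀≤ : E₀ ≤ suc K₀
  E₀≤ = ≤-pred (≤-trans (≤-reflexive (+-comm 1 E₀)) (≤-trans (+-monoʳ-≤ E₀ 1≤Y) E₀+Y≤suc-suc-K₀))

+≤1 : ∀ {A X} → A + X ≤ 1 → 1 ≤ A → A ≡ 1 × X ≡ 0
+≤1 {A} {X} A+X≤1 1≤A = ≤-antisym (m+n≤o⇒m≤o A A+X≤1) 1≤A , n≤0⇒n≡0 (≤-pred (≤-trans (+-monoˡ-≤ X 1≤A) A+X≤1))

lookup-[]≔-[]≔ : ∀ {A : Set} {n} (x : Vec A n) w v b k → k ≢ w → k ≢ v → lookup ((x [ w ]≔ b) [ v ]≔ b) k ≡ lookup x k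
lookup-[]≔-[]≔ x w v b k k≢w k≢v = trans (lookup∘update′ k≢v (x [ w ]≔ b) b) (lookup∘update′ k≢w x b)

-- What tightness leaves along x_i when the relevant variables of g₁ are among those of g₀.
module Tight₀ {m} (g : BoolFn (suc m)) (g⁺ : Positive g) (i : Fin (suc m)) (t₁ : Vec Bool m)
  (t₁-at₁ : Along.MinTrueAt₁ g g⁺ i t₁) (t₁-unique : ∀ y → Along.MinTrueAt₁ g g⁺ i y → y ≡ t₁)
  (maxFalse₁⊆₀ : ∀ y → MaxFalse (restrict g i true) y → MaxFalse (restrict g i false) y) where
  open Lift g g⁺ i

  g₁-false-off-t₁ : ∀ w → Forces g₀ w false false → ∀ v → lookup t₁ v ≡ true →
                    ∀ y → lookup y w ≡ false → lookup y v ≡ false → g₁ y ≡ false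
  g₁-false-off-t₁ w forces v t₁ᵥ y y_w y_v with g₁ y in e
  ... | false = refl
  ... | true with minTrue-below g₁ y e
  ... | t , t⪯y , t-min = ⊥-elim (true≢false (trans (sym (t⪯y v (subst (λ u → lookup u v ≡ true) (sym t≡t₁) t₁ᵥ))) y_v))
    where
    t_w : lookup t w ≡ false
    t_w = ¬-not λ t_w → true≢false (trans (sym (t⪯y w t_w)) y_w)
    t≡t₁ : t ≡ t₁
    t≡t₁ = t₁-unique t (t-min , forces t t_w)

  forces-false-lifts-on-t₁ : ∀ v → Forces g₀ v false false → lookup t₁ v ≡ true → Forces g (punchIn i v) false false
  forces-false-lifts-on-t₁ v forces t₁ᵥ z z_v with insertAt-surjective z i
  ... | y , b , refl with trans (sym (insertAt-punchIn y i b v)) z_v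
  ... | y_v with b
  ... | false = forces y y_v
  ... | true = g₁-false-off-t₁ v forces v t₁ᵥ y y_v y_v

  -- With w forcing g₀ false, w ∉ t₁ and v ∈ t₁, the point p that is 0 exactly at w and v is a maximal
  -- false point of g₁, hence of g₀; that contradicts g₀ being false at the larger point 0 only at w.
  g₀-false-below-coatom : ∀ w v → Forces g₀ w false false → lookup t₁ w ≡ false → lookup t₁ v ≡ true →
                          g₀ (replicate m true [ v ]≔ false) ≡ false
  g₀-false-below-coatom w v forces t₁_w t₁ᵥ with g₀ (replicate m true [ v ]≔ false) in e
  ... | false = refl
  ... | true = ⊥-elim (true≢false (trans (sym q_v) (trans (cong (λ u → lookup u v) q≡p) p_v)))
    where
    v≢w : v ≢ w
    v≢w v≡w = true≢false (trans (sym t₁ᵥ) (trans (cong (lookup t₁) v≡w) t₁_w))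
    q = replicate m true [ w ]≔ false
    p = q [ v ]≔ false
    p-elsewhere : ∀ k → k ≢ w → k ≢ v → lookup p k ≡ true
    p-elsewhere k k≢w k≢v = trans (lookup-[]≔-[]≔ (replicate m true) w v false k k≢w k≢v) (lookup-replicate k true)
    p_v : lookup p v ≡ false
    p_v = lookup∘update v q false
    p_w : lookup p w ≡ false
    p_w = trans (lookup∘update′ (v≢w ∘ sym) q false) (lookup∘update w (replicate m true) false)
    q_v : lookup q v ≡ true
    q_v = trans (lookup∘update′ v≢w (replicate m true) false) (lookup-replicate v true)
    raise : ∀ {x} k → (∀ k′ → k′ ≢ k → lookup x k′ ≡ true → lookup p k′ ≡ true) → x ⪯ (p [ k ]≔ true)
    raise k elsewhere k′ xₖ′ with k ≟ᶠ k′
    ... | yes refl = lookup∘update k p true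
    ... | no k≢k′ = trans (lookup∘update′ (k≢k′ ∘ sym) p true) (elsewhere k′ (k≢k′ ∘ sym) xₖ′)
    p-locally-maximal : ∀ k → lookup p k ≡ false → g₁ (p [ k ]≔ true) ≡ true
    p-locally-maximal k pₖ with k ≟ᶠ w | k ≟ᶠ v
    ... | yes refl | _ = g₁⁺ _ _ (g₀⇒g₁ _ e) (raise {replicate m true [ v ]≔ false} k λ k′ k′≢w eₖ′ →
                           p-elsewhere k′ k′≢w λ { refl → true≢false (trans (sym eₖ′) (lookup∘update k′ (replicate m true) false)) })
    ... | no _ | yes refl = g₁⁺ t₁ _ (proj₁ (proj₁ t₁-at₁)) (raise {t₁} k λ k′ k′≢v t₁ₖ′ →
                              p-elsewhere k′ (λ { refl → true≢false (trans (sym t₁ₖ′) t₁_w) }) k′≢v)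
    ... | no k≢w | no k≢v = ⊥-elim (true≢false (trans (sym (p-elsewhere k k≢w k≢v)) pₖ))
    q≡p : q ≡ p
    q≡p = proj₂ (maxFalse₁⊆₀ p (maxFalse-local g₁⁺ p (g₁-false-off-t₁ w forces v t₁ᵥ p p_w p_v) p-locally-maximal))
                q ([]≔false-⪯ q v) (forces q (lookup∘update w (replicate m true) false))

  forcing-lifts : Constant g₀ ⊎ Forcing g₀ → Constant g ⊎ Forcing g
  forcing-lifts (inj₁ (true , const)) = inj₁ (constant-if-g₀-true const)
  forcing-lifts (inj₁ (false , const)) = inj₂ (i , false , false , forces-if-restriction-constant false false const)
  forcing-lifts (inj₂ (w , true , true , forces)) = inj₂ (punchIn i w , true , true , forces-true-lifts w forces)
  forcing-lifts (inj₂ (w , true , false , forces)) =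
    inj₂ (i , false , false , forces-if-restriction-constant false false (forces-everywhere-false g₀⁺ w forces))
  forcing-lifts (inj₂ (w , false , true , forces)) = inj₁ (constant-if-g₀-true (forces-everywhere-true g₀⁺ w forces))
  forcing-lifts (inj₂ (w , false , false , forces)) with lookup t₁ w in t₁_w
  ... | true = inj₂ (punchIn i w , false , false , forces-false-lifts-on-t₁ w forces t₁_w)
  ... | false with any? (λ v → lookup t₁ v ≟ᵇ true)
  ...   | yes (v , t₁ᵥ) = inj₂ (punchIn i v , false , false , forces-false-lifts-on-t₁ v
            (forces-if-false-below-coatom g₀⁺ v (g₀-false-below-coatom w v forces t₁_w t₁ᵥ)) t₁ᵥ)
  ...   | no ¬∃ = inj₂ (i , true , true , forces-if-restriction-constant true true
            (everywhere-true-if-true-at-zero g₁⁺ t₁ (proj₁ (proj₁ t₁-at₁)) (λ k t₁ₖ → ¬∃ (k , t₁ₖ))))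

module Tight₁ {m} (g : BoolFn (suc m)) (g⁺ : Positive g) (i : Fin (suc m)) (f₀ : Vec Bool m)
  (f₀-at₀ : Along.MaxFalseAt₀ g g⁺ i f₀) (f₀-unique : ∀ y → Along.MaxFalseAt₀ g g⁺ i y → y ≡ f₀)
  (minTrue₀⊆₁ : ∀ y → MinTrue (restrict g i false) y → MinTrue (restrict g i true) y) where
  open Lift g g⁺ i

  g₀-true-off-f₀ : ∀ w → Forces g₁ w true true → ∀ v → lookup f₀ v ≡ false →
                   ∀ y → lookup y w ≡ true → lookup y v ≡ true → g₀ y ≡ true
  g₀-true-off-f₀ w forces v f₀ᵥ y y_w y_v with g₀ y in e
  ... | true = refl
  ... | false with maxFalse-above g₀ y e
  ... | t , y⪯t , t-max = ⊥-elim (true≢false (trans (sym (y⪯t v y_v)) (subst (λ u → lookup u v ≡ false) (sym t≡f₀) f₀ᵥ)))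
    where
    t≡f₀ : t ≡ f₀
    t≡f₀ = f₀-unique t (t-max , forces t (y⪯t w y_w))

  forces-true-lifts-off-f₀ : ∀ v → Forces g₁ v true true → lookup f₀ v ≡ false → Forces g (punchIn i v) true true
  forces-true-lifts-off-f₀ v forces f₀ᵥ z z_v with insertAt-surjective z i
  ... | y , b , refl with trans (sym (insertAt-punchIn y i b v)) z_v
  ... | y_v with b
  ... | true = forces y y_v
  ... | false = g₀-true-off-f₀ v forces v f₀ᵥ y y_v y_v

  -- Dual to Tight₀.g₀-false-below-coatom: the point 1 exactly at w and v is a minimal true point of g₀.
  g₁-true-above-atom : ∀ w v → Forces g₁ w true true → lookup f₀ w ≡ true → lookup f₀ v ≡ false →
                       g₁ (replicate m false [ v ]≔ true) ≡ true
  g₁-true-above-atom w v forces f₀_w f₀ᵥ with g₁ (replicate m false [ v ]≔ true) in e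
  ... | true = refl
  ... | false = ⊥-elim (true≢false (trans (sym p_v) (trans (cong (λ u → lookup u v) (sym q≡p)) q_v)))
    where
    v≢w : v ≢ w
    v≢w v≡w = true≢false (trans (sym f₀_w) (trans (cong (lookup f₀) (sym v≡w)) f₀ᵥ))
    q = replicate m false [ w ]≔ true
    p = q [ v ]≔ true
    p-elsewhere : ∀ k → k ≢ w → k ≢ v → lookup p k ≡ false
    p-elsewhere k k≢w k≢v = trans (lookup-[]≔-[]≔ (replicate m false) w v true k k≢w k≢v) (lookup-replicate k false)
    p_v : lookup p v ≡ true
    p_v = lookup∘update v q true
    p_w : lookup p w ≡ true
    p_w = trans (lookup∘update′ (v≢w ∘ sym) q true) (lookup∘update w (replicate m false) true)
    q_v : lookup q v ≡ false
    q_v = trans (lookup∘update′ v≢w (replicate m false) true) (lookup-replicate v false)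
    lower : ∀ {x} k → (∀ k′ → k′ ≢ k → lookup p k′ ≡ true → lookup x k′ ≡ true) → (p [ k ]≔ false) ⪯ x
    lower k elsewhere k′ pₖ′ with k ≟ᶠ k′
    ... | yes refl = ⊥-elim (true≢false (trans (sym pₖ′) (lookup∘update k p false)))
    ... | no k≢k′ = elsewhere k′ (k≢k′ ∘ sym) (trans (sym (lookup∘update′ (k≢k′ ∘ sym) p false)) pₖ′)
    p-only : ∀ k → lookup p k ≡ true → k ≢ w → k ≡ v
    p-only k pₖ k≢w with k ≟ᶠ v
    ... | yes k≡v = k≡v
    ... | no k≢v = ⊥-elim (true≢false (trans (sym pₖ) (p-elsewhere k k≢w k≢v)))
    p-w : ∀ k → lookup p k ≡ true → k ≢ v → k ≡ w
    p-w k pₖ k≢v with k ≟ᶠ w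
    ... | yes k≡w = k≡w
    ... | no k≢w = ⊥-elim (true≢false (trans (sym pₖ) (p-elsewhere k k≢w k≢v)))
    p-locally-minimal : ∀ k → lookup p k ≡ true → g₀ (p [ k ]≔ false) ≡ false
    p-locally-minimal k pₖ with k ≟ᶠ w | k ≟ᶠ v
    ... | yes refl | _ = ¬g₁⇒¬g₀ _ (¬-not λ g₁p′ → true≢false (trans (sym (g₁⁺ _ _ g₁p′
                           (lower {replicate m false [ v ]≔ true} k λ k′ k′≢w pₖ′ →
                             subst (λ u → lookup (replicate m false [ v ]≔ true) u ≡ true) (sym (p-only k′ pₖ′ k′≢w))
                                   (lookup∘update v (replicate m false) true)))) e))
    ... | no _ | yes refl = ¬-not λ g₀p′ → true≢false (trans (sym (g₀⁺ _ f₀ g₀p′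
                              (lower {f₀} k λ k′ k′≢v pₖ′ → subst (λ u → lookup f₀ u ≡ true) (sym (p-w k′ pₖ′ k′≢v)) f₀_w)))
                            (proj₁ (proj₁ f₀-at₀)))
    ... | no k≢w | no k≢v = ⊥-elim (true≢false (trans (sym pₖ) (p-elsewhere k k≢w k≢v)))
    q≡p : q ≡ p
    q≡p = proj₂ (minTrue₀⊆₁ p (minTrue-local g₀⁺ p (g₀-true-off-f₀ w forces v f₀ᵥ p p_w p_v) p-locally-minimal))
                q (⪯-[]≔true q v) (forces q (lookup∘update w (replicate m false) true))

  forcing-lifts : Constant g₁ ⊎ Forcing g₁ → Constant g ⊎ Forcing g
  forcing-lifts (inj₁ (false , const)) = inj₁ (constant-if-g₁-false const)
  forcing-lifts (inj₁ (true , const)) = inj₂ (i , true , true , forces-if-restriction-constant true true const)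
  forcing-lifts (inj₂ (w , false , false , forces)) = inj₂ (punchIn i w , false , false , forces-false-lifts w forces)
  forcing-lifts (inj₂ (w , true , false , forces)) = inj₁ (constant-if-g₁-false (forces-everywhere-false g₁⁺ w forces))
  forcing-lifts (inj₂ (w , false , true , forces)) =
    inj₂ (i , true , true , forces-if-restriction-constant true true (forces-everywhere-true g₁⁺ w forces))
  forcing-lifts (inj₂ (w , true , true , forces)) with lookup f₀ w in f₀_w
  ... | false = inj₂ (punchIn i w , true , true , forces-true-lifts-off-f₀ w forces f₀_w)
  ... | true with any? (λ v → lookup f₀ v ≟ᵇ false)
  ...   | yes (v , f₀ᵥ) = inj₂ (punchIn i v , true , true , forces-true-lifts-off-f₀ v
            (forces-if-true-above-atom g₁⁺ v (g₁-true-above-atom w v forces f₀_w f₀ᵥ)) f₀ᵥ)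
  ...   | no ¬∃ = inj₂ (i , false , false , forces-if-restriction-constant false false
            (everywhere-false-if-false-at-one g₀⁺ f₀ (proj₁ (proj₁ f₀-at₀)) (λ k f₀ₖ → ¬∃ (k , f₀ₖ))))

module _ {m} (g : BoolFn (suc m)) (g⁺ : Positive g) (i : Fin (suc m)) where
  open Along g g⁺ i

  tight₀ : Pivotal g i → (∀ j → Pivotal g₁ j → Pivotal g₀ j) → #extremal g ≡ suc (#pivotal g) →
           #extremal g₀ ≡ suc (#pivotal g₀) × #MinTrueAt₁ ≡ 1 × #MaxFalse₁∖₀ ≡ 0
  tight₀ piv ₁⊆₀ tight =
    let A+X≤1 , tight-g₀ = squeeze #extremal₀-bound tight (#pivotal≤suc-#pivotal₀ ₁⊆₀)
                                   (#pivotal<#extremal m g₀ g₀⁺) (≤-trans (pivotal⇒#MinTrueAt₁≥1 piv) (m≤m+n _ _))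
    in tight-g₀ , +≤1 A+X≤1 (pivotal⇒#MinTrueAt₁≥1 piv)

  tight₁ : Pivotal g i → (∀ j → Pivotal g₀ j → Pivotal g₁ j) → #extremal g ≡ suc (#pivotal g) →
           #extremal g₁ ≡ suc (#pivotal g₁) × #MaxFalseAt₀ ≡ 1 × #MinTrue₀∖₁ ≡ 0
  tight₁ piv ₀⊆₁ tight =
    let B+Z≤1 , tight-g₁ = squeeze #extremal₁-bound tight (#pivotal≤suc-#pivotal₁ ₀⊆₁)
                                   (#pivotal<#extremal m g₁ g₁⁺) (≤-trans (pivotal⇒#MaxFalseAt₀≥1 piv) (m≤m+n _ _))
    in tight-g₁ , +≤1 B+Z≤1 (pivotal⇒#MaxFalseAt₀≥1 piv)

  #MaxFalse₁∖₀≡0⇒⊆ : #MaxFalse₁∖₀ ≡ 0 → ∀ y → MaxFalse g₁ y → MaxFalse g₀ y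
  #MaxFalse₁∖₀≡0⇒⊆ X≡0 y max₁ = decidable-stable (MaxFalse? g₀ y)
    λ ¬max₀ → 𝟙≡0⇒ (MaxFalse₁∖₀? y) (cubeSum≡0⇒ (𝟙 ∘ MaxFalse₁∖₀?) X≡0 y) (max₁ , ¬max₀)

  #MinTrue₀∖₁≡0⇒⊆ : #MinTrue₀∖₁ ≡ 0 → ∀ y → MinTrue g₀ y → MinTrue g₁ y
  #MinTrue₀∖₁≡0⇒⊆ Z≡0 y min₀ = decidable-stable (MinTrue? g₁ y)
    λ ¬min₁ → 𝟙≡0⇒ (MinTrue₀∖₁? y) (cubeSum≡0⇒ (𝟙 ∘ MinTrue₀∖₁?) Z≡0 y) (min₀ , ¬min₁)

tight⇒forcing : ∀ n (g : BoolFn n) → Positive g → #extremal g ≡ suc (#pivotal g) → Constant g ⊎ Forcing g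
tight⇒forcing zero g g⁺ tight = inj₁ (g [] , λ { [] → refl })
tight⇒forcing (suc m) g g⁺ tight with any? (Pivotal? g)
... | no ¬∃ = inj₁ (no-pivotal⇒constant g g⁺ ¬∃)
... | yes ∃piv = split (splitting-variable g g⁺ ∃piv)
  where
  split : ∃ (λ i → Pivotal g i × NestedRestrictions g i) → Constant g ⊎ Forcing g
  split (i , piv , inj₁ ₁⊆₀) =
    let tight-g₀ , A≡1 , X≡0 = tight₀ g g⁺ i piv ₁⊆₀ tight
        t₁ , t₁-at₁ , t₁-unique = cubeCount≡1⇒∃! m (Along.MinTrueAt₁? g g⁺ i) A≡1
    in Tight₀.forcing-lifts g g⁺ i t₁ t₁-at₁ t₁-unique (#MaxFalse₁∖₀≡0⇒⊆ g g⁺ i X≡0)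
         (tight⇒forcing m (restrict g i false) (restrict-positive g⁺ i false) tight-g₀)
  split (i , piv , inj₂ ₀⊆₁) =
    let tight-g₁ , B≡1 , Z≡0 = tight₁ g g⁺ i piv ₀⊆₁ tight
        f₀ , f₀-at₀ , f₀-unique = cubeCount≡1⇒∃! m (Along.MaxFalseAt₀? g g⁺ i) B≡1
    in Tight₁.forcing-lifts g g⁺ i f₀ f₀-at₀ f₀-unique (#MinTrue₀∖₁≡0⇒⊆ g g⁺ i Z≡0)
         (tight⇒forcing m (restrict g i true) (restrict-positive g⁺ i true) tight-g₁)

litVal-[]≔-same : ∀ {n} (y : Vec Bool n) j p → litVal (y [ j ]≔ p) j p ≡ true
litVal-[]≔-same y j true = lookup∘update j y true
litVal-[]≔-same y j false = cong not (lookup∘update j y false)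

litVal-[]≔-opposite : ∀ {n} (y : Vec Bool n) j p → litVal (y [ j ]≔ not p) j p ≡ false
litVal-[]≔-opposite y j true = lookup∘update j y false
litVal-[]≔-opposite y j false = cong not (lookup∘update j y true)

litVal-cong : ∀ {n n′} (x : Vec Bool n) (x′ : Vec Bool n′) j j′ p → lookup x j ≡ lookup x′ j′ →
              litVal x j p ≡ litVal x′ j′ p
litVal-cong x x′ j j′ true e = e
litVal-cong x x′ j j′ false e = cong not e

litVal-[]≔-other : ∀ {n} (y : Vec Bool n) j k v p → k ≢ j → litVal (y [ k ]≔ v) j p ≡ litVal y j p
litVal-[]≔-other y j k v p k≢j = litVal-cong (y [ k ]≔ v) y j j p (lookup∘update′ (k≢j ∘ sym) y v)

eval-[]≔-∉ : ∀ {n vs} (t : Nested n vs) k → k ∉ vs → ∀ y v → eval t (y [ k ]≔ v) ≡ eval t y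
eval-[]≔-∉ (lit j p) k k∉ y v = litVal-[]≔-other y j k v p (k∉ ∘ here)
eval-[]≔-∉ (ext j p true t _) k k∉ y v =
  cong₂ _∨_ (litVal-[]≔-other y j k v p (k∉ ∘ here)) (eval-[]≔-∉ t k (k∉ ∘ there) y v)
eval-[]≔-∉ (ext j p false t _) k k∉ y v =
  cong₂ _∧_ (litVal-[]≔-other y j k v p (k∉ ∘ here)) (eval-[]≔-∉ t k (k∉ ∘ there) y v)

eval-nonconstant : ∀ {n vs} (t : Nested n vs) → (∃ λ y → eval t y ≡ false) × (∃ λ y → eval t y ≡ true)
eval-nonconstant {n} (lit j p) =
  (replicate n true [ j ]≔ not p , litVal-[]≔-opposite (replicate n true) j p) ,
  (replicate n true [ j ]≔ p , litVal-[]≔-same (replicate n true) j p)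
eval-nonconstant (ext j p true t j∉) =
  let (y , t-false) , _ = eval-nonconstant t in
  (y [ j ]≔ not p , cong₂ _∨_ (litVal-[]≔-opposite y j p) (trans (eval-[]≔-∉ t j j∉ y (not p)) t-false)) ,
  (y [ j ]≔ p , cong (_∨ eval t (y [ j ]≔ p)) (litVal-[]≔-same y j p))
eval-nonconstant (ext j p false t j∉) =
  let _ , (y , t-true) = eval-nonconstant t in
  (y [ j ]≔ not p , cong (_∧ eval t (y [ j ]≔ not p)) (litVal-[]≔-opposite y j p)) ,
  (y [ j ]≔ p , cong₂ _∧_ (litVal-[]≔-same y j p) (trans (eval-[]≔-∉ t j j∉ y p) t-true))

positive-literal : ∀ {n} {f : BoolFn n} → Positive f → ∀ j p y →
                   (∀ b → f (y [ j ]≔ b) ≡ litVal (y [ j ]≔ b) j p) → p ≡ true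
positive-literal f⁺ j true y f≡lit = refl
positive-literal {f = f} f⁺ j false y f≡lit =
  ⊥-elim (true≢false (trans (sym (f⁺ _ _ f-at-false y[j]⪯)) (trans (f≡lit true) (litVal-[]≔-opposite y j false))))
  where
  f-at-false : f (y [ j ]≔ false) ≡ true
  f-at-false = trans (f≡lit false) (litVal-[]≔-same y j false)
  y[j]⪯ : (y [ j ]≔ false) ⪯ (y [ j ]≔ true)
  y[j]⪯ = ⪯-trans {x = y [ j ]≔ false} {y = y} {z = y [ j ]≔ true} ([]≔false-⪯ y j) (⪯-[]≔true y j)

positive-lit : ∀ {n} {f : BoolFn n} → Positive f → ∀ j p → (∀ x → f x ≡ litVal x j p) → p ≡ true
positive-lit {n} f⁺ j p f≡ = positive-literal f⁺ j p (replicate n false) (λ b → f≡ _)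

positive-ext : ∀ {n vs} {f : BoolFn n} → Positive f → ∀ j p op (t : Nested n vs) j∉ →
               (∀ x → f x ≡ eval (ext j p op t j∉) x) → p ≡ true
positive-ext f⁺ j p true t j∉ f≡ =
  let y , t-false = proj₁ (eval-nonconstant t) in
  positive-literal f⁺ j p y λ b → trans (f≡ _) (trans (cong (litVal (y [ j ]≔ b) j p ∨_) (trans (eval-[]≔-∉ t j j∉ y b) t-false))
                                                       (∨-identityʳ _))
positive-ext f⁺ j p false t j∉ f≡ =
  let y , t-true = proj₂ (eval-nonconstant t) in
  positive-literal f⁺ j p y λ b → trans (f≡ _) (trans (cong (litVal (y [ j ]≔ b) j p ∧_) (trans (eval-[]≔-∉ t j j∉ y b) t-true))
                                                       (∧-identityʳ _))

module _ {m} (i : Fin (suc m)) where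

  weaken : ∀ {vs} → Nested m vs → Nested (suc m) (map (punchIn i) vs)
  weaken (lit j p) = lit (punchIn i j) p
  weaken (ext j p op t j∉) = ext (punchIn i j) p op (weaken t) λ pj∈ →
    let j′ , j′∈ , pj≡pj′ = ∈-map⁻ (punchIn i) pj∈ in j∉ (subst (_∈ _) (sym (punchIn-injective i j j′ pj≡pj′)) j′∈)

  ∉-weaken : ∀ vs → i ∉ map (punchIn i) vs
  ∉-weaken vs i∈ = let j , _ , i≡pj = ∈-map⁻ (punchIn i) i∈ in punchInᵢ≢i i j (sym i≡pj)

  eval-weaken : ∀ {vs} (t : Nested m vs) y b → eval (weaken t) (insertAt y i b) ≡ eval t y
  eval-weaken (lit j p) y b = litVal-cong (insertAt y i b) y (punchIn i j) j p (insertAt-punchIn y i b j)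
  eval-weaken (ext j p true t _) y b = cong₂ _∨_ (eval-weaken (lit j p) y b) (eval-weaken t y b)
  eval-weaken (ext j p false t _) y b = cong₂ _∧_ (eval-weaken (lit j p) y b) (eval-weaken t y b)

  Strengthening : ∀ {vs} → Nested (suc m) vs → Set
  Strengthening {vs} t = Σ (List (Fin m)) λ vs′ → Σ (Nested m vs′) λ t′ →
    (∀ y b → eval t′ y ≡ eval t (insertAt y i b)) × (∀ j → j ∈ vs′ → punchIn i j ∈ vs)

  litVal-insertAt-punchOut : ∀ {k} (i≢k : i ≢ k) y b p → litVal y (punchOut i≢k) p ≡ litVal (insertAt y i b) k p
  litVal-insertAt-punchOut {k} i≢k y b p = litVal-cong y (insertAt y i b) (punchOut i≢k) k p
    (sym (trans (cong (lookup (insertAt y i b)) (sym (punchIn-punchOut i≢k))) (insertAt-punchIn y i b _)))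

  strengthen : ∀ {vs} (t : Nested (suc m) vs) → i ∉ vs → Strengthening t
  strengthen (lit k p) i∉ = [ punchOut i≢k ] , lit (punchOut i≢k) p , (λ y b → litVal-insertAt-punchOut i≢k y b p) ,
                            λ { j (here refl) → here (punchIn-punchOut i≢k) }
    where i≢k = i∉ ∘ here
  strengthen (ext k p op t k∉) i∉ with strengthen t (i∉ ∘ there)
  ... | vs′ , t′ , eval≡ , ∈vs = punchOut i≢k ∷ vs′ , ext (punchOut i≢k) p op t′ fresh , eval≡′ op , ∈vs′
    where
    i≢k = i∉ ∘ here
    fresh : punchOut i≢k ∉ vs′
    fresh ∈vs′ = k∉ (subst (_∈ _) (punchIn-punchOut i≢k) (∈vs _ ∈vs′))
    eval≡′ : ∀ op y b → eval (ext (punchOut i≢k) p op t′ fresh) y ≡ eval (ext k p op t k∉) (insertAt y i b)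
    eval≡′ true y b = cong₂ _∨_ (litVal-insertAt-punchOut i≢k y b p) (eval≡ y b)
    eval≡′ false y b = cong₂ _∧_ (litVal-insertAt-punchOut i≢k y b p) (eval≡ y b)
    ∈vs′ : ∀ j → j ∈ punchOut i≢k ∷ vs′ → punchIn i j ∈ k ∷ _
    ∈vs′ j (here refl) = here (punchIn-punchOut i≢k)
    ∈vs′ j (there j∈) = there (∈vs j j∈)

module _ {n} {h : BoolFn n} where

  #minTrue-everywhere-false : (∀ y → h y ≡ false) → #minTrue h ≡ 0
  #minTrue-everywhere-false h-false =
    cubeSum-zero λ y → 𝟙-no (MinTrue? h y) λ (hy , _) → true≢false (trans (sym hy) (h-false y))

  #maxFalse-everywhere-true : (∀ y → h y ≡ true) → #maxFalse h ≡ 0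
  #maxFalse-everywhere-true h-true =
    cubeSum-zero λ y → 𝟙-no (MaxFalse? h y) λ (hy , _) → true≢false (trans (sym (h-true y)) hy)

  #minTrue-everywhere-true : (∀ y → h y ≡ true) → #minTrue h ≡ 1
  #minTrue-everywhere-true h-true = trans
    (cubeSum-supported _ (replicate n false) λ y y≢0 →
      𝟙-no (MinTrue? h y) λ (_ , minimal) → y≢0 (sym (minimal _ (replicate-false-⪯ y) (h-true _))))
    (𝟙-yes (MinTrue? h _) (h-true _ , λ y y⪯0 _ → ⪯-replicate-false y y⪯0))

  #maxFalse-everywhere-false : (∀ y → h y ≡ false) → #maxFalse h ≡ 1
  #maxFalse-everywhere-false h-false = trans
    (cubeSum-supported _ (replicate n true) λ y y≢1 →
      𝟙-no (MaxFalse? h y) λ (_ , maximal) → y≢1 (sym (maximal _ (⪯-replicate-true y) (h-false _))))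
    (𝟙-yes (MaxFalse? h _) (h-false _ , λ y 1⪯y _ → replicate-true-⪯ y 1⪯y))

  #pivotal-constant : Constant h → #pivotal h ≡ 0
  #pivotal-constant (c , h≡c) = #pivotal≡0 h λ (k , z , _ , hz , hz′) →
    true≢false (trans (sym hz′) (trans (h≡c _) (trans (sym (h≡c z)) hz)))

  constant-counts : Constant h → #extremal h ≡ 1 × #pivotal h ≡ 0
  constant-counts (true , h-true) =
    cong₂ _+_ (#minTrue-everywhere-true h-true) (#maxFalse-everywhere-true h-true) , #pivotal-constant (true , h-true)
  constant-counts (false , h-false) =
    cong₂ _+_ (#minTrue-everywhere-false h-false) (#maxFalse-everywhere-false h-false) , #pivotal-constant (false , h-false)

module _ {m} (g : BoolFn (suc m)) (g⁺ : Positive g) (i : Fin (suc m)) where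
  open Along g g⁺ i

  ∨-counts : (∀ y → g₁ y ≡ true) → ∀ y₀ → g₀ y₀ ≡ false →
             #extremal g ≡ suc (#extremal g₀) × #pivotal g ≡ suc (#pivotal g₀)
  ∨-counts g₁-true y₀ g₀y₀ = #extremal≡ , #pivotal≡
    where
    g₀-zero : g₀ (replicate m false) ≡ false
    g₀-zero = ¬-not λ g₀0 → true≢false (trans (sym (g₀⁺ _ y₀ g₀0 (replicate-false-⪯ y₀))) g₀y₀)
    #A≡1 : #MinTrueAt₁ ≡ 1
    #A≡1 = trans (cubeSum-cong λ y → 𝟙-cong (MinTrueAt₁? y) (MinTrue? g₁ y) proj₁ λ (g₁y , minimal) →
                    (g₁y , minimal) , subst (λ v → g₀ v ≡ false) (minimal _ (replicate-false-⪯ y) (g₁-true _)) g₀-zero)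
                 (#minTrue-everywhere-true g₁-true)
    #B≡ : #MaxFalseAt₀ ≡ #maxFalse g₀
    #B≡ = cubeSum-cong λ y → 𝟙-cong (MaxFalseAt₀? y) (MaxFalse? g₀ y) proj₁ (_, g₁-true y)
    #extremal≡ : #extremal g ≡ suc (#extremal g₀)
    #extremal≡ = begin
      #extremal g                                                 ≡⟨ #extremal-split ⟩
      (#minTrue g₀ + #MinTrueAt₁) + (#MaxFalseAt₀ + #maxFalse g₁) ≡⟨ cong₂ _+_ (cong (#minTrue g₀ +_) #A≡1)
                                                                       (cong₂ _+_ #B≡ (#maxFalse-everywhere-true g₁-true)) ⟩
      (#minTrue g₀ + 1) + (#maxFalse g₀ + 0)                      ≡⟨ cong₂ _+_ (+-comm (#minTrue g₀) 1) (+-identityʳ _) ⟩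
      suc (#extremal g₀) ∎
      where open ≡-Reasoning
    #pivotal≡ : #pivotal g ≡ suc (#pivotal g₀)
    #pivotal≡ = trans #pivotal-split (cong₂ _+_ (𝟙-yes (Pivotal? g i) (Equivalence.from pivotal-self (y₀ , g₀y₀ , g₁-true y₀)))
      (sum-cong-≗ λ j → 𝟙-cong (Pivotal? g₀ j ⊎-dec Pivotal? g₁ j) (Pivotal? g₀ j)
         (λ { (inj₁ p) → p ; (inj₂ (z , _ , g₁z , _)) → ⊥-elim (true≢false (trans (sym (g₁-true z)) g₁z)) }) inj₁))

  ∧-counts : (∀ y → g₀ y ≡ false) → ∀ y₁ → g₁ y₁ ≡ true →
             #extremal g ≡ suc (#extremal g₁) × #pivotal g ≡ suc (#pivotal g₁)
  ∧-counts g₀-false y₁ g₁y₁ = #extremal≡ , #pivotal≡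
    where
    g₁-one : g₁ (replicate m true) ≡ true
    g₁-one = g₁⁺ y₁ _ g₁y₁ (⪯-replicate-true y₁)
    #B≡1 : #MaxFalseAt₀ ≡ 1
    #B≡1 = trans (cubeSum-cong λ y → 𝟙-cong (MaxFalseAt₀? y) (MaxFalse? g₀ y) proj₁ λ (g₀y , maximal) →
                    (g₀y , maximal) , subst (λ v → g₁ v ≡ true) (maximal _ (⪯-replicate-true y) (g₀-false _)) g₁-one)
                 (#maxFalse-everywhere-false g₀-false)
    #A≡ : #MinTrueAt₁ ≡ #minTrue g₁
    #A≡ = cubeSum-cong λ y → 𝟙-cong (MinTrueAt₁? y) (MinTrue? g₁ y) proj₁ (_, g₀-false y)
    #extremal≡ : #extremal g ≡ suc (#extremal g₁)
    #extremal≡ = begin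
      #extremal g                                                 ≡⟨ #extremal-split ⟩
      (#minTrue g₀ + #MinTrueAt₁) + (#MaxFalseAt₀ + #maxFalse g₁) ≡⟨ cong₂ _+_ (cong₂ _+_ (#minTrue-everywhere-false g₀-false) #A≡)
                                                                       (cong (_+ #maxFalse g₁) #B≡1) ⟩
      #minTrue g₁ + suc (#maxFalse g₁)                            ≡⟨ +-suc (#minTrue g₁) (#maxFalse g₁) ⟩
      suc (#extremal g₁) ∎
      where open ≡-Reasoning
    #pivotal≡ : #pivotal g ≡ suc (#pivotal g₁)
    #pivotal≡ = trans #pivotal-split (cong₂ _+_ (𝟙-yes (Pivotal? g i) (Equivalence.from pivotal-self (y₁ , g₀-false y₁ , g₁y₁)))
      (sum-cong-≗ λ j → 𝟙-cong (Pivotal? g₀ j ⊎-dec Pivotal? g₁ j) (Pivotal? g₁ j)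
         (λ { (inj₂ p) → p ; (inj₁ (z , _ , _ , g₀z′)) → ⊥-elim (true≢false (trans (sym g₀z′) (g₀-false _))) }) inj₂))

≗-by-insertAt : ∀ {m} {A : Set} (i : Fin (suc m)) {f h : Vec Bool (suc m) → A} →
                (∀ y b → f (insertAt y i b) ≡ h (insertAt y i b)) → ∀ x → f x ≡ h x
≗-by-insertAt i {f} {h} f≡h x with insertAt-surjective x i
... | y , b , refl = f≡h y b

module _ {m} (g : BoolFn (suc m)) (g⁺ : Positive g) (i : Fin (suc m)) where
  open Along g g⁺ i

  ∨-linearReadOnce : (∀ y → g₁ y ≡ true) → ∃ (λ y → g₀ y ≡ false) → LinearReadOnce g₀ → LinearReadOnce g
  ∨-linearReadOnce g₁-true (y₀ , g₀y₀) (inj₁ (true , g₀-true)) = ⊥-elim (true≢false (trans (sym (g₀-true y₀)) g₀y₀))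
  ∨-linearReadOnce g₁-true _ (inj₁ (false , g₀-false)) = inj₂ ([ i ] , lit i true , ≗-by-insertAt i g≡)
    where
    g≡ : ∀ y b → g (insertAt y i b) ≡ lookup (insertAt y i b) i
    g≡ y false = trans (g₀-false y) (sym (insertAt-lookup y i false))
    g≡ y true = trans (g₁-true y) (sym (insertAt-lookup y i true))
  ∨-linearReadOnce g₁-true _ (inj₂ (vs , t , g₀≡t)) =
    inj₂ (i ∷ map (punchIn i) vs , ext i true true (weaken i t) (∉-weaken i vs) , ≗-by-insertAt i g≡)
    where
    g≡ : ∀ y b → g (insertAt y i b) ≡ lookup (insertAt y i b) i ∨ eval (weaken i t) (insertAt y i b)
    g≡ y false = trans (g₀≡t y) (sym (trans (cong (_∨ eval (weaken i t) (insertAt y i false)) (insertAt-lookup y i false))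
                                            (eval-weaken i t y false)))
    g≡ y true = trans (g₁-true y) (sym (cong (_∨ eval (weaken i t) (insertAt y i true)) (insertAt-lookup y i true)))

  ∧-linearReadOnce : (∀ y → g₀ y ≡ false) → ∃ (λ y → g₁ y ≡ true) → LinearReadOnce g₁ → LinearReadOnce g
  ∧-linearReadOnce g₀-false (y₁ , g₁y₁) (inj₁ (false , g₁-false)) = ⊥-elim (true≢false (trans (sym g₁y₁) (g₁-false y₁)))
  ∧-linearReadOnce g₀-false _ (inj₁ (true , g₁-true)) = inj₂ ([ i ] , lit i true , ≗-by-insertAt i g≡)
    where
    g≡ : ∀ y b → g (insertAt y i b) ≡ lookup (insertAt y i b) i
    g≡ y false = trans (g₀-false y) (sym (insertAt-lookup y i false))
    g≡ y true = trans (g₁-true y) (sym (insertAt-lookup y i true))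
  ∧-linearReadOnce g₀-false _ (inj₂ (vs , t , g₁≡t)) =
    inj₂ (i ∷ map (punchIn i) vs , ext i true false (weaken i t) (∉-weaken i vs) , ≗-by-insertAt i g≡)
    where
    g≡ : ∀ y b → g (insertAt y i b) ≡ lookup (insertAt y i b) i ∧ eval (weaken i t) (insertAt y i b)
    g≡ y false = trans (g₀-false y) (sym (cong (_∧ eval (weaken i t) (insertAt y i false)) (insertAt-lookup y i false)))
    g≡ y true = trans (g₁≡t y) (sym (trans (cong (_∧ eval (weaken i t) (insertAt y i true)) (insertAt-lookup y i true))
                                           (eval-weaken i t y true)))

-- Tightness characterises linear read-once functions

tight-step : ∀ {E K E′ K′ : ℕ} → E ≡ suc E′ → K ≡ suc K′ → E′ ≡ suc K′ → E ≡ suc K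
tight-step E≡ K≡ E′≡ = trans E≡ (trans (cong suc E′≡) (cong suc (sym K≡)))

linearReadOnce⇒tight : ∀ n (g : BoolFn n) → Positive g → LinearReadOnce g → #extremal g ≡ suc (#pivotal g)
linearReadOnce⇒tight n g g⁺ (inj₁ const) = let E≡1 , K≡0 = constant-counts const in trans E≡1 (cong suc (sym K≡0))
linearReadOnce⇒tight zero g g⁺ (inj₂ (_ , lit () _ , _))
linearReadOnce⇒tight zero g g⁺ (inj₂ (_ , ext () _ _ _ _ , _))
linearReadOnce⇒tight (suc m) g g⁺ (inj₂ (_ , lit k p , g≡)) with positive-lit g⁺ k p g≡
... | refl =
  let E≡ , K≡ = ∨-counts g g⁺ k (λ y → trans (g≡ _) (insertAt-lookup y k true)) (replicate m false) (g₀-false _)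
  in tight-step E≡ K≡ (linearReadOnce⇒tight m g₀ g₀⁺ (inj₁ (false , g₀-false)))
  where
  open Along g g⁺ k
  g₀-false : ∀ y → g₀ y ≡ false
  g₀-false y = trans (g≡ _) (insertAt-lookup y k false)
linearReadOnce⇒tight (suc m) g g⁺ (inj₂ (_ , ext k p op t k∉ , g≡)) with positive-ext g⁺ k p op t k∉ g≡
... | refl with strengthen k t k∉
... | _ , t′ , eval-t′ , _ = ext-tight op g≡
  where
  open Along g g⁺ k
  ext-tight : ∀ op → (∀ x → g x ≡ eval (ext k true op t k∉) x) → #extremal g ≡ suc (#pivotal g)
  ext-tight true g≡ =
    let y₀ , t′y₀ = proj₁ (eval-nonconstant t′)
        E≡ , K≡ = ∨-counts g g⁺ k g₁-true y₀ (trans (g₀≡t′ y₀) t′y₀)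
    in tight-step E≡ K≡ (linearReadOnce⇒tight m g₀ g₀⁺ (inj₂ (_ , t′ , g₀≡t′)))
    where
    g₁-true : ∀ y → g₁ y ≡ true
    g₁-true y = trans (g≡ _) (cong (_∨ eval t (insertAt y k true)) (insertAt-lookup y k true))
    g₀≡t′ : ∀ y → g₀ y ≡ eval t′ y
    g₀≡t′ y = trans (g≡ _) (trans (cong (_∨ eval t (insertAt y k false)) (insertAt-lookup y k false)) (sym (eval-t′ y false)))
  ext-tight false g≡ =
    let y₁ , t′y₁ = proj₂ (eval-nonconstant t′)
        E≡ , K≡ = ∧-counts g g⁺ k g₀-false y₁ (trans (g₁≡t′ y₁) t′y₁)
    in tight-step E≡ K≡ (linearReadOnce⇒tight m g₁ g₁⁺ (inj₂ (_ , t′ , g₁≡t′)))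
    where
    g₀-false : ∀ y → g₀ y ≡ false
    g₀-false y = trans (g≡ _) (cong (_∧ eval t (insertAt y k false)) (insertAt-lookup y k false))
    g₁≡t′ : ∀ y → g₁ y ≡ eval t′ y
    g₁≡t′ y = trans (g≡ _) (trans (cong (_∧ eval t (insertAt y k true)) (insertAt-lookup y k true)) (sym (eval-t′ y true)))

tight-unstep : ∀ {E K E′ K′ : ℕ} → E ≡ suc E′ → K ≡ suc K′ → E ≡ suc K → E′ ≡ suc K′
tight-unstep E≡ K≡ E≡K = suc-injective (trans (sym E≡) (trans E≡K (cong suc K≡)))

tight⇒linearReadOnce : ∀ n (g : BoolFn n) → Positive g → #extremal g ≡ suc (#pivotal g) → LinearReadOnce g
tight⇒linearReadOnce n g g⁺ tight = from-forcing n g g⁺ tight (tight⇒forcing n g g⁺ tight)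
  where
  from-forcing : ∀ n (g : BoolFn n) → Positive g → #extremal g ≡ suc (#pivotal g) → Constant g ⊎ Forcing g → LinearReadOnce g
  from-forcing n g g⁺ tight (inj₁ const) = inj₁ const
  from-forcing zero g g⁺ tight (inj₂ (() , _))
  from-forcing (suc m) g g⁺ tight (inj₂ (k , false , true , forces)) = inj₁ (true , forces-everywhere-true g⁺ k forces)
  from-forcing (suc m) g g⁺ tight (inj₂ (k , true , false , forces)) = inj₁ (false , forces-everywhere-false g⁺ k forces)
  from-forcing (suc m) g g⁺ tight (inj₂ (k , true , true , forces)) = ∨-case (∃ᵛ? m (λ y → g₀ y ≟ᵇ false))
    where
    open Lift g g⁺ k
    g₁-true : ∀ y → g₁ y ≡ true
    g₁-true y = forces _ (insertAt-lookup y k true)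
    ∨-case : Dec (∃ λ y → g₀ y ≡ false) → LinearReadOnce g
    ∨-case (no ¬∃) = inj₁ (constant-if-g₀-true λ y → ¬-not (¬∃ ∘ (y ,_)))
    ∨-case (yes (y₀ , g₀y₀)) = let E≡ , K≡ = ∨-counts g g⁺ k g₁-true y₀ g₀y₀ in
      ∨-linearReadOnce g g⁺ k g₁-true (y₀ , g₀y₀) (tight⇒linearReadOnce m g₀ g₀⁺ (tight-unstep E≡ K≡ tight))
  from-forcing (suc m) g g⁺ tight (inj₂ (k , false , false , forces)) = ∧-case (∃ᵛ? m (λ y → g₁ y ≟ᵇ true))
    where
    open Lift g g⁺ k
    g₀-false : ∀ y → g₀ y ≡ false
    g₀-false y = forces _ (insertAt-lookup y k false)
    ∧-case : Dec (∃ λ y → g₁ y ≡ true) → LinearReadOnce g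
    ∧-case (no ¬∃) = inj₁ (constant-if-g₁-false λ y → ¬-not (¬∃ ∘ (y ,_)))
    ∧-case (yes (y₁ , g₁y₁)) = let E≡ , K≡ = ∧-counts g g⁺ k g₀-false y₁ g₁y₁ in
      ∧-linearReadOnce g g⁺ k g₀-false (y₁ , g₁y₁) (tight⇒linearReadOnce m g₁ g₁⁺ (tight-unstep E≡ K≡ tight))

module CubeCounting {n} = Counting {Vec Bool n} _≟ᵛ_ (cubeSum n) cubeSum-cong cubeSum-+ (cubeSum-zero {n} (λ _ → refl)) cubeSum-point
module FinCounting {n} = Counting {Fin n} _≟ᶠ_ sum sum-cong-≗ ∑-distrib-+ (sum-replicate-zero n) sum-point

length-relevant : ∀ {n} (f : BoolFn n) → Positive f → (rel : List (Fin n)) → Unique rel →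
                  (∀ i → (i ∈ rel) ⇔ Relevant f i) → length rel ≡ #pivotal f
length-relevant f f⁺ rel unique rel⇔ = FinCounting.length-enumeration rel unique (Pivotal? f) λ k →
  mk⇔ (Equivalence.to (relevant⇔pivotal f⁺ k) ∘ Equivalence.to (rel⇔ k))
      (Equivalence.from (rel⇔ k) ∘ Equivalence.from (relevant⇔pivotal f⁺ k))

length-extremal : ∀ {n} (f : BoolFn n) (xs : List (Vec Bool n)) → Unique xs →
                  (∀ x → (x ∈ xs) ⇔ Extremal f x) → length xs ≡ #extremal f
length-extremal {n} f xs unique xs⇔ = begin
  length xs                                                        ≡⟨ CubeCounting.length-enumeration xs unique extremal? xs⇔ ⟩
  cubeSum n (𝟙 ∘ extremal?)                                        ≡⟨ cubeSum-cong 𝟙-extremal ⟩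
  cubeSum n (λ x → 𝟙 (MaxFalse? f x) + 𝟙 (MinTrue? f x))           ≡⟨ cubeSum-+ (𝟙 ∘ MaxFalse? f) (𝟙 ∘ MinTrue? f) ⟩
  #maxFalse f + #minTrue f                                         ≡⟨ +-comm (#maxFalse f) (#minTrue f) ⟩
  #extremal f ∎
  where
  open ≡-Reasoning
  extremal? : ∀ x → Dec (Extremal f x)
  extremal? x = MaxFalse? f x ⊎-dec MinTrue? f x
  𝟙-extremal : ∀ x → 𝟙 (extremal? x) ≡ 𝟙 (MaxFalse? f x) + 𝟙 (MinTrue? f x)
  𝟙-extremal x = 𝟙-⊎ (MaxFalse? f x) (MinTrue? f x) λ ((fx , _) , (fx′ , _)) → true≢false (trans (sym fx′) fx)

lemma2 : ∀ (n : ℕ) (f : BoolFn n) → Positive f → Canalyzing f →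
    (rel : List (Fin n)) → Unique rel → (∀ i → (i ∈ rel) ⇔ Relevant f i) →
    (ext : List (Vec Bool n)) → Unique ext → (∀ x → (x ∈ ext) ⇔ Extremal f x) →
    (suc (length rel) ≤ length ext)
      × ((length ext ≡ suc (length rel)) ⇔ LinearReadOnce f)
lemma2 n f f⁺ _ rel rel-unique rel⇔ extremal extremal-unique extremal⇔ =
  subst₂ (λ K E → suc K ≤ E) (sym |rel|) (sym |ext|) (#pivotal<#extremal n f f⁺) ,
  mk⇔ (λ tight → tight⇒linearReadOnce n f f⁺ (trans (sym |ext|) (trans tight (cong suc |rel|))))
      (λ lro → trans |ext| (trans (linearReadOnce⇒tight n f f⁺ lro) (cong suc (sym |rel|))))
  where
  |rel| : length rel ≡ #pivotal f
  |rel| = length-relevant f f⁺ rel rel-unique rel⇔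
  |ext| : length extremal ≡ #extremal f
  |ext| = length-extremal f extremal extremal-unique extremal⇔
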